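{- Let $k\geq1$. Let $\grave{f}_{k,n,j}$ be the number of $k$-box paths of size $n$ with exactly $j$ returns, and let $\grave{F}_{k}(t,x)=\sum_{n\geq1}\sum_{j\geq1}\grave{f}_{k,n,j}t^{j}x^{n}$. Let \[G_{k+1}(x)=\sum_{n\geq0}\frac{1}{(k+2)n+1}\binom{(k+2)n+1}{n}x^{n}\] (the generating function of augmented $(k+1)$-Dyck paths by size). Then, as formal power series, \[\grave{F}_{k}(t,x)=\frac{t\,x\,G_{k+1}(x)^{k}}{1-t\,x\,G_{k+1}(x)^{k+1}}.\]
   Context: A skew Dyck path is a word $w$ over $\{U,D,L\}$ such that: $w$ contains neither $UL$ nor $LU$ as a contiguous subword; the number of $U$s equals the total number of $D$s and $L$s; and in every prefix the total number of $D$s and $L$s is at most the number of $U$s. Geometrically $U=(1,1)$, $D=(1,-1)$, $L=(-1,-1)$ starting at the origin. Its semilength is its number of $U$s. A factor is a contiguous subword; $X^{m}$ denotes $m$ consecutive copies of $X$. For $k\geq1$, a $k$-box path of size $n$ is a skew Dyck path of semilength $(k+2)n-1$ containing exactly $n$ occurrences of the factor $UD^{k}L$. A return of a path is a point where a step of the path ends on the $x$-axis (equivalently, a nonempty prefix in which the number of $U$s equals the total number of $D$s and $L$s). An augmented $m$-Dyck path of size $n$ ($m\geq 2$) is a skew Dyck path of the form $U^{a_{1}}D^{m-1}LD\cdots U^{a_{n}}D^{m-1}LD$ with positive integers $a_i$. -}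

module Defs where

open import Data.Bool using (Bool; true; false; _∧_; not)
open import Data.Nat as ℕ using (ℕ; zero; suc; _∸_; _≡ᵇ_)
open import Data.Nat.Combinatorics using (_C_)
open import Data.List using (List; []; _∷_; _++_; length; filter; concatMap; map)
open import Data.Integer using (+_)
open import Data.Rational as ℚ using (ℚ; 0ℚ; 1ℚ; _/_)
open import Relation.Nullary.Decidable using (T?)
open import Relation.Binary.PropositionalEquality using (_≡_)

data Step : Set where
  U D L : Step

words : ℕ → List (List Step)
words zero    = [] ∷ []
words (suc m) = concatMap (λ w → (U ∷ w) ∷ (D ∷ w) ∷ (L ∷ w) ∷ []) (words m)

noULnorLU : List Step → Bool
noULnorLU (U ∷ L ∷ _) = false
noULnorLU (L ∷ U ∷ _) = false
noULnorLU (_ ∷ w)     = noULnorLU w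
noULnorLU []          = true

-- walk h w : starting with (#U − #D − #L) = h ≥ 0 so far, every prefix of w
-- keeps #D + #L ≤ #U, and at the end #U = #D + #L.
walk : ℕ → List Step → Bool
walk zero    []      = true
walk (suc _) []      = false
walk h       (U ∷ w) = walk (suc h) w
walk zero    (D ∷ w) = false
walk (suc h) (D ∷ w) = walk h w
walk zero    (L ∷ w) = false
walk (suc h) (L ∷ w) = walk h w

isSkewDyck : List Step → Bool
isSkewDyck w = noULnorLU w ∧ walk 0 w

-- number of U steps (the semilength)
countU : List Step → ℕ
countU []      = 0
countU (U ∷ w) = suc (countU w)
countU (_ ∷ w) = countU w

_==ˢ_ : Step → Step → Bool
U ==ˢ U = true
D ==ˢ D = true
L ==ˢ L = true
_ ==ˢ _ = false

isPrefixOf : List Step → List Step → Bool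
isPrefixOf []      _       = true
isPrefixOf (_ ∷ _) []      = false
isPrefixOf (a ∷ p) (b ∷ w) = (a ==ˢ b) ∧ isPrefixOf p w

occurrences : List Step → List Step → ℕ
occurrences p []          = 0
occurrences p w@(_ ∷ w')  with isPrefixOf p w
... | true  = suc (occurrences p w')
... | false = occurrences p w'

rep : ℕ → Step → List Step
rep zero    _ = []
rep (suc m) s = s ∷ rep m s

boxFactor : ℕ → List Step
boxFactor k = U ∷ (rep k D ++ (L ∷ []))

-- number of returns, i.e. of steps ending on the x-axis; h is the current height
returnsFrom : ℕ → List Step → ℕ
returnsFrom h       []      = 0
returnsFrom h       (U ∷ w) = returnsFrom (suc h) w
returnsFrom zero    (_ ∷ w) = returnsFrom zero w      -- never used for skew Dyck paths
returnsFrom (suc zero) (_ ∷ w) = suc (returnsFrom zero w)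
returnsFrom (suc (suc h)) (_ ∷ w) = returnsFrom (suc h) w

returns : List Step → ℕ
returns = returnsFrom 0

-- A k-box path of size n: skew Dyck path of semilength (k+2)n−1 with exactly
-- n occurrences of the factor U D^k L.  A skew Dyck path of semilength m has
-- length 2m, so we enumerate all words of that length.

isKBoxPathWithReturns : ℕ → ℕ → ℕ → List Step → Bool
isKBoxPathWithReturns k n j w =
  isSkewDyck w ∧ (countU w ≡ᵇ ((k ℕ.+ 2) ℕ.* n ∸ 1))
    ∧ (occurrences (boxFactor k) w ≡ᵇ n) ∧ (returns w ≡ᵇ j)

fBox : ℕ → ℕ → ℕ → ℕ
fBox k n j = length (filter (λ w → T? (isKBoxPathWithReturns k n j w))
                            (words (2 ℕ.* ((k ℕ.+ 2) ℕ.* n ∸ 1))))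

-- Formal power series in two variables t, x over ℚ:
-- a series A is given by its coefficients, A i n = [t^i x^n] A.

PS : Set
PS = ℕ → ℕ → ℚ

_≈ₚ_ : PS → PS → Set
A ≈ₚ B = ∀ i n → A i n ≡ B i n

infix 4 _≈ₚ_

sumTo : ℕ → (ℕ → ℚ) → ℚ
sumTo zero    f = f 0
sumTo (suc m) f = sumTo m f ℚ.+ f (suc m)

_⋆_ : PS → PS → PS
(A ⋆ B) i n = sumTo i (λ a → sumTo n (λ b → A a b ℚ.* B (i ∸ a) (n ∸ b)))

infixl 7 _⋆_

oneₚ : PS
oneₚ zero zero = 1ℚ
oneₚ _    _    = 0ℚ

tₚ : PS
tₚ (suc zero) zero = 1ℚ
tₚ _          _    = 0ℚ

xₚ : PS
xₚ zero (suc zero) = 1ℚ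
xₚ _    _          = 0ℚ

powₚ : PS → ℕ → PS
powₚ A zero    = oneₚ
powₚ A (suc m) = powₚ A m ⋆ A

-- 1/(1 − B) = Σ_{m≥0} B^m for a series B with zero constant term; since then
-- B^m has no monomial of total degree < m, the coefficient of t^i x^n only
-- receives contributions from m ≤ i + n.
geomₚ : PS → PS
geomₚ B i n = sumTo (i ℕ.+ n) (λ m → powₚ B m i n)

F̀ : ℕ → PS
F̀ k zero    _       = 0ℚ
F̀ k (suc j) zero    = 0ℚ
F̀ k (suc j) (suc n) = (+ fBox k (suc n) (suc j)) / 1

Gcoeff : ℕ → ℕ → ℚ
Gcoeff m n = (+ (suc ((m ℕ.+ 1) ℕ.* n) C n)) / suc ((m ℕ.+ 1) ℕ.* n)

G : ℕ → PS
G m zero    n = Gcoeff m n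
G m (suc _) _ = 0ℚ

-- In a k-box path every L ends a box U Dᵏ L, every other D immediately follows a
-- box, and every return is the L of a box or the D after it.  Reading the path
-- backwards, a finite automaton on (height, boxes left, returns left) therefore
-- recognises exactly the k-box paths of size n with j returns, and its counting
-- recursion is that of the Raney numbers: with q = k + 2,
--   f̀_{k,n,j} = raney q (n − j) (k + (j − 1)(k + 1)),
-- each return before the last costing height k + 1.  Since Σₘ raney q m r xᵐ is
-- G_{k+1}(x)ʳ, this is also the coefficient of tʲ xⁿ on the right, namely that of
-- xⁿ⁻ʲ in G_{k+1}^k (G_{k+1}^(k+1))^(j−1).

module Submission where

open import Defs
open import Data.Nat using (ℕ; zero; suc; _≤_; _∸_; _≤?_)
open import Data.Nat.Properties using (m∸n+n≡m; ≰⇒>)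
open import Relation.Binary.PropositionalEquality using (sym; trans; cong)
open import Relation.Nullary using (yes; no)

module Raney where

  open import Data.Nat using (ℕ; zero; suc; _+_; _*_; _∸_)
  open import Data.Nat.Properties
  open import Data.Nat.Combinatorics using (_C_; nCk+nC[k+1]≡[n+1]C[k+1]; nC1≡n)
  open import Algebra.Properties.CommutativeSemigroup +-commutativeSemigroup using (interchange; xy∙z≈xz∙y)
  open import Relation.Binary.PropositionalEquality
  open import Data.Nat.Solver using (module +-*-Solver)
  open +-*-Solver
  open ≡-Reasoning

  -- The Raney numbers r/(qm+r) · binom(qm+r, m) (raney-closedForm), through the
  -- recursion of the lattice paths they count.
  raney : ℕ → ℕ → ℕ → ℕ
  raney q zero    r       = 1
  raney q (suc m) zero    = 0
  raney q (suc m) (suc r) = raney q (suc m) r + raney q m (r + q)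

  sumToℕ : ℕ → (ℕ → ℕ) → ℕ
  sumToℕ zero    f = f 0
  sumToℕ (suc m) f = sumToℕ m f + f (suc m)

  sumToℕ-cong : ∀ m {f g} → (∀ x → f x ≡ g x) → sumToℕ m f ≡ sumToℕ m g
  sumToℕ-cong zero    f≡g = f≡g 0
  sumToℕ-cong (suc m) f≡g = cong₂ _+_ (sumToℕ-cong m f≡g) (f≡g (suc m))

  sumToℕ-unfoldˡ : ∀ m f → sumToℕ (suc m) f ≡ f 0 + sumToℕ m (λ x → f (suc x))
  sumToℕ-unfoldˡ zero    f = refl
  sumToℕ-unfoldˡ (suc m) f =
    trans (cong (_+ f (suc (suc m))) (sumToℕ-unfoldˡ m f)) (+-assoc (f 0) _ _)

  sumToℕ-+ : ∀ m f g → sumToℕ m (λ x → f x + g x) ≡ sumToℕ m f + sumToℕ m g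
  sumToℕ-+ zero    f g = refl
  sumToℕ-+ (suc m) f g =
    trans (cong (_+ (f (suc m) + g (suc m))) (sumToℕ-+ m f g))
          (interchange (sumToℕ m f) (sumToℕ m g) (f (suc m)) (g (suc m)))

  sumToℕ-zero : ∀ m → sumToℕ m (λ _ → 0) ≡ 0
  sumToℕ-zero zero    = refl
  sumToℕ-zero (suc m) = cong (_+ 0) (sumToℕ-zero m)

  raney-+ : ∀ q m r s → raney q m (r + s) ≡ sumToℕ m (λ b → raney q b r * raney q (m ∸ b) s)
  raney-+ q zero    r       s = refl
  raney-+ q (suc m) zero    s = sym (begin
    sumToℕ (suc m) (λ b → R b 0 * R (suc m ∸ b) s)  ≡⟨ sumToℕ-unfoldˡ m _ ⟩
    1 * R (suc m) s + sumToℕ m (λ _ → 0)            ≡⟨ cong₂ _+_ (*-identityˡ _) (sumToℕ-zero m) ⟩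
    R (suc m) s + 0                                 ≡⟨ +-identityʳ _ ⟩
    R (suc m) s                                     ∎)
    where R = raney q
  raney-+ q (suc m) (suc r) s = sym (begin
    sumToℕ (suc m) (λ b → R b (suc r) * R (suc m ∸ b) s)
      ≡⟨ sumToℕ-unfoldˡ m _ ⟩
    R 0 r * R (suc m) s + sumToℕ m (λ b → (R (suc b) r + R b (r + q)) * R (m ∸ b) s)
      ≡⟨ cong (R 0 r * R (suc m) s +_) (trans
           (sumToℕ-cong m (λ b → *-distribʳ-+ (R (m ∸ b) s) (R (suc b) r) (R b (r + q))))
           (sumToℕ-+ m _ _)) ⟩
    R 0 r * R (suc m) s + (sumToℕ m (λ b → R (suc b) r * R (m ∸ b) s)
                           + sumToℕ m (λ b → R b (r + q) * R (m ∸ b) s))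
      ≡⟨ +-assoc (R 0 r * R (suc m) s) _ _ ⟨
    R 0 r * R (suc m) s + sumToℕ m (λ b → R (suc b) r * R (m ∸ b) s)
                        + sumToℕ m (λ b → R b (r + q) * R (m ∸ b) s)
      ≡⟨ cong (_+ sumToℕ m (λ b → R b (r + q) * R (m ∸ b) s)) (sumToℕ-unfoldˡ m _) ⟨
    sumToℕ (suc m) (λ b → R b r * R (suc m ∸ b) s) + sumToℕ m (λ b → R b (r + q) * R (m ∸ b) s)
      ≡⟨ cong₂ _+_ (raney-+ q (suc m) r s) (raney-+ q m (r + q) s) ⟨
    R (suc m) (r + s) + R m ((r + q) + s)
      ≡⟨ cong (λ z → R (suc m) (r + s) + R m z) (xy∙z≈xz∙y r q s) ⟩
    R (suc m) (suc r + s)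
      ∎)
    where R = raney q

  [k+1]*[n+1]C[k+1]≡[n+1]*nCk : ∀ n k → suc k * (suc n C suc k) ≡ suc n * (n C k)
  [k+1]*[n+1]C[k+1]≡[n+1]*nCk zero    zero    = refl
  [k+1]*[n+1]C[k+1]≡[n+1]*nCk zero    (suc k) = *-zeroʳ (suc (suc k))
  [k+1]*[n+1]C[k+1]≡[n+1]*nCk (suc n) zero    =
    trans (+-identityʳ _) (trans (nC1≡n (suc (suc n))) (sym (*-identityʳ (suc (suc n)))))
  [k+1]*[n+1]C[k+1]≡[n+1]*nCk (suc n) (suc k) = begin
    suc (suc k) * (suc (suc n) C suc (suc k))
      ≡⟨ cong (suc (suc k) *_) (nCk+nC[k+1]≡[n+1]C[k+1] (suc n) (suc k)) ⟨
    suc (suc k) * (suc n C suc k + suc n C suc (suc k))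
      ≡⟨ *-distribˡ-+ (suc (suc k)) (suc n C suc k) _ ⟩
    (suc n C suc k + suc k * (suc n C suc k)) + suc (suc k) * (suc n C suc (suc k))
      ≡⟨ cong₂ (λ a b → (suc n C suc k + a) + b)
               ([k+1]*[n+1]C[k+1]≡[n+1]*nCk n k) ([k+1]*[n+1]C[k+1]≡[n+1]*nCk n (suc k)) ⟩
    (suc n C suc k + suc n * (n C k)) + suc n * (n C suc k)
      ≡⟨ +-assoc (suc n C suc k) _ _ ⟩
    suc n C suc k + (suc n * (n C k) + suc n * (n C suc k))
      ≡⟨ cong (suc n C suc k +_) (*-distribˡ-+ (suc n) (n C k) (n C suc k)) ⟨
    suc n C suc k + suc n * (n C k + n C suc k)
      ≡⟨ cong (λ z → suc n C suc k + suc n * z) (nCk+nC[k+1]≡[n+1]C[k+1] n k) ⟩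
    suc (suc n) * (suc n C suc k)
      ∎

  -- Multiplied by M N, the step is a polynomial identity once M · binom(N, M) is
  -- eliminated by Pascal's rule and absorption.
  private
    closedForm-step : ∀ q m r → let M = suc m; N = M * suc q + r in
      N * raney (suc q) M r ≡ r * (N C M) →
      N * raney (suc q) m (r + suc q) ≡ (r + suc q) * (N C m) →
      suc N * raney (suc q) M (suc r) ≡ suc r * (suc N C M)
    closedForm-step q′ m r ih₁ ih₂ =
      *-cancelˡ-≡ (suc N * raney q M (suc r)) (suc r * (suc N C M)) (M * N) (begin
      M * N * (suc N * (T₁ + T₂))
        ≡⟨ solve 5 (λ M N N₊ T₁ T₂ → M :* N :* (N₊ :* (T₁ :+ T₂))
                                  := N₊ :* (M :* (N :* T₁) :+ M :* (N :* T₂)))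
             refl M N (suc N) T₁ T₂ ⟩
      suc N * (M * (N * T₁) + M * (N * T₂))
        ≡⟨ cong₂ (λ a b → suc N * (M * a + M * b)) ih₁ ih₂ ⟩
      suc N * (M * (r * A) + M * ((r + q) * c))
        ≡⟨ cong (suc N *_) (+-cancelʳ-≡ (r * (M * c)) _ _ rearrange) ⟩
      suc N * (N * suc r * c)
        ≡⟨ solve 4 (λ N N₊ r c → N₊ :* (N :* r :* c) := N :* r :* (N₊ :* c)) refl N (suc N) (suc r) c ⟩
      N * suc r * (suc N * c)
        ≡⟨ cong (N * suc r *_) absorb ⟨
      N * suc r * (M * (suc N C M))
        ≡⟨ solve 4 (λ M N r C → N :* r :* (M :* C) := M :* N :* (r :* C)) refl M N (suc r) (suc N C M) ⟩
      M * N * (suc r * (suc N C M))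
        ∎)
      where
      q = suc q′
      M = suc m
      N = M * q + r
      T₁ = raney q M r
      T₂ = raney q m (r + q)
      A = N C M
      c = N C m
      absorb : M * (suc N C M) ≡ suc N * c
      absorb = [k+1]*[n+1]C[k+1]≡[n+1]*nCk N m
      pascal : M * A + M * c ≡ suc N * c
      pascal = begin
        M * A + M * c    ≡⟨ +-comm (M * A) _ ⟩
        M * c + M * A    ≡⟨ *-distribˡ-+ M c A ⟨
        M * (c + A)      ≡⟨ cong (M *_) (nCk+nC[k+1]≡[n+1]C[k+1] N m) ⟩
        M * (suc N C M)  ≡⟨ absorb ⟩
        suc N * c        ∎
      rearrange : M * (r * A) + M * ((r + q) * c) + r * (M * c) ≡ N * suc r * c + r * (M * c)
      rearrange = begin
        M * (r * A) + M * ((r + q) * c) + r * (M * c)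
          ≡⟨ solve 5 (λ M r q A c → M :* (r :* A) :+ M :* ((r :+ q) :* c) :+ r :* (M :* c)
                                  := r :* (M :* A :+ M :* c) :+ M :* ((r :+ q) :* c)) refl M r q A c ⟩
        r * (M * A + M * c) + M * ((r + q) * c)
          ≡⟨ cong (λ z → r * z + M * ((r + q) * c)) pascal ⟩
        r * (suc N * c) + M * ((r + q) * c)
          ≡⟨ solve 4 (λ M r q c → r :* ((con 1 :+ (M :* q :+ r)) :* c) :+ M :* ((r :+ q) :* c)
                                := (M :* q :+ r) :* (con 1 :+ r) :* c :+ r :* (M :* c)) refl M r q c ⟩
        N * suc r * c + r * (M * c)
          ∎

  raney-closedForm : ∀ q m r → (m * suc q + r) * raney (suc q) m r ≡ r * ((m * suc q + r) C m)
  raney-closedForm q zero    r       = trans (*-identityʳ r) (sym (*-identityʳ r))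
  raney-closedForm q (suc m) zero    = *-zeroʳ (suc m * suc q + 0)
  raney-closedForm q (suc m) (suc r) =
    subst (λ N → N * raney (suc q) (suc m) (suc r) ≡ suc r * (N C suc m))
      (sym (+-suc (suc m * suc q) r))
      (closedForm-step q m r (raney-closedForm q (suc m) r)
        (subst (λ N → N * raney (suc q) m (r + suc q) ≡ (r + suc q) * (N C m))
          (solve 3 (λ m q r → m :* q :+ (r :+ q) := (con 1 :+ m) :* q :+ r) refl m (suc q) r)
          (raney-closedForm q m (r + suc q))))

module WordCount where

  open import Data.Bool using (Bool; true; false; if_then_else_)
  open import Data.Nat using (ℕ; zero; suc; _+_)
  open import Data.Nat.Properties using (+-assoc)
  open import Data.List using (List; []; _∷_; _++_; [_]; length; filter; concatMap)
  open import Relation.Nullary.Decidable using (T?)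
  open import Relation.Binary.PropositionalEquality hiding ([_])
  open import Data.Nat.Solver using (module +-*-Solver)
  open +-*-Solver
  open ≡-Reasoning

  count : (List Step → Bool) → List (List Step) → ℕ
  count p []       = 0
  count p (w ∷ ws) = (if p w then 1 else 0) + count p ws

  length-filter : ∀ p ws → length (filter (λ w → T? (p w)) ws) ≡ count p ws
  length-filter p []       = refl
  length-filter p (w ∷ ws) with p w
  ... | true  = cong suc (length-filter p ws)
  ... | false = length-filter p ws

  count-++ : ∀ p xs ys → count p (xs ++ ys) ≡ count p xs + count p ys
  count-++ p []       ys = refl
  count-++ p (x ∷ xs) ys =
    trans (cong (_ +_) (count-++ p xs ys)) (sym (+-assoc (if p x then 1 else 0) _ _))

  count-cong : ∀ {p p′} → (∀ w → p w ≡ p′ w) → ∀ ws → count p ws ≡ count p′ ws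
  count-cong p≡p′ []       = refl
  count-cong p≡p′ (w ∷ ws) = cong₂ (λ b n → (if b then 1 else 0) + n) (p≡p′ w) (count-cong p≡p′ ws)

  #words : ℕ → (List Step → Bool) → ℕ
  #words m p = count p (words m)

  #words-cong : ∀ {p p′} → (∀ w → p w ≡ p′ w) → ∀ m → #words m p ≡ #words m p′
  #words-cong p≡p′ m = count-cong p≡p′ (words m)

  #words-suc : ∀ m p →
    #words (suc m) p ≡ #words m (λ w → p (U ∷ w)) + #words m (λ w → p (D ∷ w)) + #words m (λ w → p (L ∷ w))
  #words-suc m p = go (words m)
    where
    oneLonger : List Step → List (List Step)
    oneLonger w = (U ∷ w) ∷ (D ∷ w) ∷ (L ∷ w) ∷ []
    go : ∀ ws → count p (concatMap oneLonger ws)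
              ≡ count (λ w → p (U ∷ w)) ws + count (λ w → p (D ∷ w)) ws + count (λ w → p (L ∷ w)) ws
    go []       = refl
    go (w ∷ ws) =
      trans (count-++ p (oneLonger w) (concatMap oneLonger ws))
        (trans (cong (count p (oneLonger w) +_) (go ws))
          (solve 6 (λ a b c A B C → (a :+ (b :+ (c :+ con 0))) :+ (A :+ B :+ C)
                                 := (a :+ A) :+ (b :+ B) :+ (c :+ C)) refl
            (if p (U ∷ w) then 1 else 0) (if p (D ∷ w) then 1 else 0) (if p (L ∷ w) then 1 else 0)
            (count (λ w → p (U ∷ w)) ws) (count (λ w → p (D ∷ w)) ws) (count (λ w → p (L ∷ w)) ws)))

  #words-suc-last : ∀ m p →
    #words (suc m) p ≡ #words m (λ w → p (w ++ [ U ])) + #words m (λ w → p (w ++ [ D ]))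
                       + #words m (λ w → p (w ++ [ L ]))
  #words-suc-last zero    p =
    solve 3 (λ a b c → a :+ (b :+ (c :+ con 0)) := (a :+ con 0) :+ (b :+ con 0) :+ (c :+ con 0)) refl
      (if p [ U ] then 1 else 0) (if p [ D ] then 1 else 0) (if p [ L ] then 1 else 0)
  #words-suc-last (suc m) p = begin
    #words (suc (suc m)) p
      ≡⟨ #words-suc (suc m) p ⟩
    #words (suc m) (λ w → p (U ∷ w)) + #words (suc m) (λ w → p (D ∷ w)) + #words (suc m) (λ w → p (L ∷ w))
      ≡⟨ cong₂ _+_ (cong₂ _+_ (#words-suc-last m _) (#words-suc-last m _)) (#words-suc-last m _) ⟩
    (#[ U , U ] + #[ U , D ] + #[ U , L ]) + (#[ D , U ] + #[ D , D ] + #[ D , L ]) + (#[ L , U ] + #[ L , D ] + #[ L , L ])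
      ≡⟨ solve 9 (λ a₁ a₂ a₃ b₁ b₂ b₃ c₁ c₂ c₃
                    → (a₁ :+ a₂ :+ a₃) :+ (b₁ :+ b₂ :+ b₃) :+ (c₁ :+ c₂ :+ c₃)
                   := (a₁ :+ b₁ :+ c₁) :+ (a₂ :+ b₂ :+ c₂) :+ (a₃ :+ b₃ :+ c₃)) refl
           #[ U , U ] #[ U , D ] #[ U , L ] #[ D , U ] #[ D , D ] #[ D , L ] #[ L , U ] #[ L , D ] #[ L , L ] ⟩
    (#[ U , U ] + #[ D , U ] + #[ L , U ]) + (#[ U , D ] + #[ D , D ] + #[ L , D ]) + (#[ U , L ] + #[ D , L ] + #[ L , L ])
      ≡⟨ cong₂ _+_ (cong₂ _+_ (#words-suc m _) (#words-suc m _)) (#words-suc m _) ⟨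
    #words (suc m) (λ w → p (w ++ [ U ])) + #words (suc m) (λ w → p (w ++ [ D ]))
      + #words (suc m) (λ w → p (w ++ [ L ]))
      ∎
    where
    #[_,_] : Step → Step → ℕ
    #[ x , y ] = #words m (λ w → p (x ∷ w ++ [ y ]))

module Words where

  open import Data.Bool using (true; false; if_then_else_)
  open import Data.Nat using (ℕ; zero; suc; _+_)
  open import Data.Nat.Properties using (+-suc)
  open import Data.Unit using (⊤)
  open import Data.Empty using (⊥)
  open import Data.Product using (∃; _×_; _,_)
  open import Data.List using (List; []; _∷_; _++_; [_])
  open import Relation.Binary.PropositionalEquality hiding ([_])

  #downs : List Step → ℕ
  #downs []      = 0
  #downs (U ∷ w) = #downs w
  #downs (D ∷ w) = suc (#downs w)
  #downs (L ∷ w) = suc (#downs w)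

  StartsU : List Step → Set
  StartsU (U ∷ _) = ⊤
  StartsU _       = ⊥

  StartsDown : List Step → Set
  StartsDown (U ∷ _) = ⊥
  StartsDown _       = ⊤

  StartsD : List Step → Set
  StartsD []      = ⊤
  StartsD (D ∷ _) = ⊤
  StartsD _       = ⊥

  noULnorLU-tail : ∀ x w → noULnorLU (x ∷ w) ≡ true → noULnorLU w ≡ true
  noULnorLU-tail U []      ok = refl
  noULnorLU-tail U (U ∷ w) ok = ok
  noULnorLU-tail U (D ∷ w) ok = ok
  noULnorLU-tail D w       ok = ok
  noULnorLU-tail L []      ok = refl
  noULnorLU-tail L (D ∷ w) ok = ok
  noULnorLU-tail L (L ∷ w) ok = ok

  noULnorLU-dropDs : ∀ c w → noULnorLU (rep c D ++ w) ≡ true → noULnorLU w ≡ true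
  noULnorLU-dropDs zero    w ok = ok
  noULnorLU-dropDs (suc c) w ok = noULnorLU-dropDs c w ok

  noULnorLU-L⇒StartsDown : ∀ w → noULnorLU (L ∷ w) ≡ true → StartsDown w
  noULnorLU-L⇒StartsDown []      _ = _
  noULnorLU-L⇒StartsDown (D ∷ _) _ = _
  noULnorLU-L⇒StartsDown (L ∷ _) _ = _
  noULnorLU-L⇒StartsDown (U ∷ _) ()

  occurrences-∷ : ∀ p x w →
    occurrences p (x ∷ w) ≡ (if isPrefixOf p (x ∷ w) then 1 else 0) + occurrences p w
  occurrences-∷ p x w with isPrefixOf p (x ∷ w)
  ... | true  = refl
  ... | false = refl

  isPrefixOf-DsL : ∀ c w → isPrefixOf (rep c D ++ [ L ]) w ≡ true → ∃ λ w′ → w ≡ rep c D ++ L ∷ w′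
  isPrefixOf-DsL zero    (L ∷ w) _ = w , refl
  isPrefixOf-DsL (suc c) (D ∷ w) p with isPrefixOf-DsL c w p
  ... | w′ , refl = w′ , refl

  #downs-DsL : ∀ c w → #downs (rep c D ++ L ∷ w) ≡ c + suc (#downs w)
  #downs-DsL zero    w = refl
  #downs-DsL (suc c) w = cong suc (#downs-DsL c w)

  walk-U : ∀ h w → walk h (U ∷ w) ≡ walk (suc h) w
  walk-U zero    w = refl
  walk-U (suc h) w = refl

  walk-DsL : ∀ c h w → walk h (rep c D ++ L ∷ w) ≡ true →
    ∃ λ h′ → h ≡ c + suc h′ × walk h′ w ≡ true
  walk-DsL zero    (suc h) w ok = h , refl , ok
  walk-DsL (suc c) (suc h) w ok with walk-DsL c h w ok
  ... | h′ , refl , ok′ = h′ , refl , ok′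

  walk-balance : ∀ h w → walk h w ≡ true → countU w + h ≡ #downs w
  walk-balance zero    []      ok = refl
  walk-balance zero    (U ∷ w) ok = trans (sym (+-suc (countU w) 0)) (walk-balance 1 w ok)
  walk-balance (suc h) (U ∷ w) ok = trans (sym (+-suc (countU w) (suc h))) (walk-balance (suc (suc h)) w ok)
  walk-balance (suc h) (D ∷ w) ok = trans (+-suc (countU w) h) (cong suc (walk-balance h w ok))
  walk-balance (suc h) (L ∷ w) ok = trans (+-suc (countU w) h) (cong suc (walk-balance h w ok))

  returnAt : ℕ → ℕ
  returnAt zero    = 1
  returnAt (suc _) = 0

  returnsFrom-DsL : ∀ c h w → returnsFrom (c + suc h) (rep c D ++ L ∷ w) ≡ returnAt h + returnsFrom h w
  returnsFrom-DsL zero    zero    w = refl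
  returnsFrom-DsL zero    (suc h) w = refl
  returnsFrom-DsL (suc c) h       w = trans (dropD c) (returnsFrom-DsL c h w)
    where
    dropD : ∀ c → returnsFrom (suc c + suc h) (rep (suc c) D ++ L ∷ w) ≡ returnsFrom (c + suc h) (rep c D ++ L ∷ w)
    dropD zero    = refl
    dropD (suc c) = refl

module BackwardReading where

  open WordCount
  open Raney
  open import Data.Bool using (Bool; true; false; if_then_else_)
  open import Data.Nat using (ℕ; zero; suc; _+_; _*_; _≤_; _<_; s≤s)
  open import Data.Nat.Properties
  open import Data.Unit using (⊤; tt)
  open import Data.List using (List; _++_; [_]; foldr)
  open import Data.List.Properties using (foldr-++)
  open import Relation.Binary.PropositionalEquality hiding ([_])
  open import Relation.Nullary using (contradiction)
  open import Data.Nat.Solver using (module +-*-Solver)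
  open +-*-Solver
  open ≡-Reasoning

  -- The automaton reads a word from right to left.  In a state  st φ h b e  the
  -- suffix read so far starts at height h, and b occurrences of U Dᵏ L and e returns
  -- are still to be read.  In phase free the next letter (to the left) may be U or
  -- D; in needL it must be L; in inBox c it must be one of the c remaining D of a
  -- box, or its initial U when c = 0.
  data Phase : Set where
    free needL : Phase
    inBox : ℕ → Phase

  data State : Set where
    dead : State
    st   : Phase → ℕ → ℕ → ℕ → State

  module Automaton (k : ℕ) where

    step : Step → State → State
    step _ dead                                = dead
    step U (st free zero b e)                  = dead
    step U (st free (suc h) b e)               = st free h b e
    step D (st free zero b zero)               = dead
    step D (st free zero b (suc e))            = st needL 1 b e
    step D (st free (suc h) b e)               = st needL (suc (suc h)) b e
    step L (st free h b e)                     = dead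
    step L (st needL zero b zero)              = dead
    step L (st needL zero b (suc e))           = st (inBox k) 1 b e
    step L (st needL (suc h) b e)              = st (inBox k) (suc (suc h)) b e
    step _ (st needL h b e)                    = dead
    step D (st (inBox zero) h b e)             = dead
    step D (st (inBox (suc c)) h b e)          = st (inBox c) (suc h) b e
    step U (st (inBox zero) zero b e)          = dead
    step U (st (inBox zero) (suc h) zero e)    = dead
    step U (st (inBox zero) (suc h) (suc b) e) = st free h b e
    step U (st (inBox (suc c)) h b e)          = dead
    step L (st (inBox c) h b e)                = dead

    -- A k-box path ends with the L of a box or with the D following one.
    start : ℕ → ℕ → State
    start b e = st needL 0 b e

    accepting : State → Bool
    accepting (st free zero zero zero) = true
    accepting _                        = false

    run : State → List Step → State
    run σ w = foldr step σ w

    #accepted : State → ℕ → ℕ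
    #accepted σ zero    = if accepting σ then 1 else 0
    #accepted σ (suc m) = #accepted (step U σ) m + #accepted (step D σ) m + #accepted (step L σ) m

    #words-accepting-run : ∀ m σ → #words m (λ w → accepting (run σ w)) ≡ #accepted σ m
    #words-accepting-run zero    σ = +-identityʳ _
    #words-accepting-run (suc m) σ = begin
      #words (suc m) (λ w → accepting (run σ w))
        ≡⟨ #words-suc-last m _ ⟩
      #words m (λ w → accepting (run σ (w ++ [ U ])))
        + #words m (λ w → accepting (run σ (w ++ [ D ])))
        + #words m (λ w → accepting (run σ (w ++ [ L ])))
        ≡⟨ cong₂ _+_ (cong₂ _+_ (lastStep U) (lastStep D)) (lastStep L) ⟩
      #accepted (step U σ) m + #accepted (step D σ) m + #accepted (step L σ) m
        ∎
      where
      lastStep : ∀ x → #words m (λ w → accepting (run σ (w ++ [ x ]))) ≡ #accepted (step x σ) m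
      lastStep x = trans (#words-cong (λ w → cong accepting (foldr-++ step σ w [ x ])) m)
                         (#words-accepting-run m (step x σ))

    #accepted-dead : ∀ m → #accepted dead m ≡ 0
    #accepted-dead zero    = refl
    #accepted-dead (suc m) rewrite #accepted-dead m = refl

    -- Every return is the L of a box or a D right after one, so a state is doomed
    -- when too few boxes are left for the returns still to be read.
    Doomed : State → Set
    Doomed dead                   = ⊤
    Doomed (st free h b e)        = b < e
    Doomed (st needL zero b e)    = b < e
    Doomed (st needL (suc h) b e) = b ≤ e
    Doomed (st (inBox c) h b e)   = b ≤ e

    step-doomed : ∀ x σ → Doomed σ → Doomed (step x σ)
    step-doomed _ dead                                _         = tt
    step-doomed U (st free zero b e)                  _         = tt
    step-doomed U (st free (suc h) b e)               b<e       = b<e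
    step-doomed D (st free zero b zero)               _         = tt
    step-doomed D (st free zero b (suc e))            (s≤s b≤e) = b≤e
    step-doomed D (st free (suc h) b e)               b<e       = <⇒≤ b<e
    step-doomed L (st free h b e)                     _         = tt
    step-doomed U (st needL h b e)                    _         = tt
    step-doomed D (st needL h b e)                    _         = tt
    step-doomed L (st needL zero b zero)              _         = tt
    step-doomed L (st needL zero b (suc e))           (s≤s b≤e) = b≤e
    step-doomed L (st needL (suc h) b e)              b≤e       = b≤e
    step-doomed D (st (inBox zero) h b e)             _         = tt
    step-doomed D (st (inBox (suc c)) h b e)          b≤e       = b≤e
    step-doomed U (st (inBox zero) zero b e)          _         = tt
    step-doomed U (st (inBox zero) (suc h) zero e)    _         = tt
    step-doomed U (st (inBox zero) (suc h) (suc b) e) b<e       = b<e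
    step-doomed U (st (inBox (suc c)) h b e)          _         = tt
    step-doomed L (st (inBox c) h b e)                _         = tt

    doomed-rejecting : ∀ σ → Doomed σ → accepting σ ≡ false
    doomed-rejecting dead                        _ = refl
    doomed-rejecting (st free zero zero zero)    ()
    doomed-rejecting (st free zero zero (suc e)) _ = refl
    doomed-rejecting (st free zero (suc b) e)    _ = refl
    doomed-rejecting (st free (suc h) b e)       _ = refl
    doomed-rejecting (st needL h b e)            _ = refl
    doomed-rejecting (st (inBox c) h b e)        _ = refl

    #accepted-doomed : ∀ m σ → Doomed σ → #accepted σ m ≡ 0
    #accepted-doomed zero    σ d rewrite doomed-rejecting σ d = refl
    #accepted-doomed (suc m) σ d
      rewrite #accepted-doomed m (step U σ) (step-doomed U σ d)
            | #accepted-doomed m (step D σ) (step-doomed D σ d)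
            | #accepted-doomed m (step L σ) (step-doomed L σ d) = refl

    #accepted-inBox : ∀ c h b e m →
      #accepted (st (inBox c) (suc h) (suc b) e) (c + suc m) ≡ #accepted (st free (c + h) b e) m
    #accepted-inBox zero    h b e m rewrite #accepted-dead m = trans (+-identityʳ _) (+-identityʳ _)
    #accepted-inBox (suc c) h b e m
      rewrite #accepted-dead (c + suc m) | #accepted-inBox c (suc h) b e m | +-suc c h = +-identityʳ _

    #accepted-needL : ∀ h b e m →
      #accepted (st needL (suc h) (suc b) e) (suc (k + suc m)) ≡ #accepted (st free (k + suc h) b e) m
    #accepted-needL h b e m rewrite #accepted-dead (k + suc m) = #accepted-inBox k (suc h) b e m

    -- Per box, the path has q = k + 2 up steps and as many down steps.
    q span : ℕ
    q    = 2 + k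
    span = q + q

    #accepted-free-noReturns : ∀ b m → #accepted (st free zero (suc b) zero) m ≡ 0
    #accepted-free-noReturns b zero    = refl
    #accepted-free-noReturns b (suc m) rewrite #accepted-dead m = refl

    -- Away from the end, a return is a D right after a box, whose U then starts at
    -- height k + 1; hence each outstanding return is charged k + 1.
    #accepted-free : ∀ b h B E → B + E ≡ b →
      #accepted (st free h b E) (h + b * span) ≡ raney q B (h + E * suc k)
    #accepted-free zero    zero    zero    zero    refl  = refl
    #accepted-free zero    zero    B       (suc E) B+E≡0 = contradiction (trans (sym (+-suc B E)) B+E≡0) (λ ())
    #accepted-free zero    (suc h) (suc B) E       ()
    #accepted-free (suc b) zero    zero    zero    ()
    #accepted-free (suc b) zero    (suc B) zero    _     = #accepted-free-noReturns b (suc b * span)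
    #accepted-free (suc b) zero    B       (suc E) B+E≡b = begin
      #accepted dead X + #accepted (st needL 1 (suc b) E) X + #accepted dead X
        ≡⟨ cong₂ _+_ (cong (_+ #accepted (st needL 1 (suc b) E) X) (#accepted-dead X)) (#accepted-dead X) ⟩
      #accepted (st needL 1 (suc b) E) X + 0
        ≡⟨ +-identityʳ _ ⟩
      #accepted (st needL 1 (suc b) E) X
        ≡⟨ cong (#accepted (st needL 1 (suc b) E))
             (solve 2 (λ k b → con 1 :+ (k :+ (con 2 :+ k) :+ b :* ((con 2 :+ k) :+ (con 2 :+ k)))
                             := con 1 :+ (k :+ (con 1 :+ ((k :+ con 1) :+ b :* ((con 2 :+ k) :+ (con 2 :+ k))))))
                    refl k b) ⟩
      #accepted (st needL 1 (suc b) E) (suc (k + suc ((k + 1) + b * span)))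
        ≡⟨ #accepted-needL zero b E _ ⟩
      #accepted (st free (k + 1) b E) ((k + 1) + b * span)
        ≡⟨ #accepted-free b (k + 1) B E (suc-injective (trans (sym (+-suc B E)) B+E≡b)) ⟩
      raney q B (k + 1 + E * suc k)
        ≡⟨ cong (λ z → raney q B (z + E * suc k)) (+-comm k 1) ⟩
      raney q B (suc E * suc k)
        ∎
      where X = suc (k + q + b * span)
    #accepted-free b (suc h) zero E E≡b = begin
      #accepted (st free h b E) X + #accepted (st needL (suc (suc h)) b E) X + #accepted dead X
        ≡⟨ cong₂ _+_ (cong₂ _+_ (#accepted-free b h zero E E≡b)
                                (#accepted-doomed X _ (≤-reflexive (sym E≡b))))
                     (#accepted-dead X) ⟩
      1
        ∎
      where X = h + b * span
    #accepted-free (suc b) (suc h) (suc B) E B+E≡b = begin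
      #accepted (st free h (suc b) E) X + #accepted (st needL (suc (suc h)) (suc b) E) X + #accepted dead X
        ≡⟨ cong₂ _+_ (cong₂ _+_ (#accepted-free (suc b) h (suc B) E B+E≡b) afterD) (#accepted-dead X) ⟩
      raney q (suc B) (h + E * suc k) + raney q B (h + E * suc k + q) + 0
        ≡⟨ +-identityʳ _ ⟩
      raney q (suc B) (suc h + E * suc k)
        ∎
      where
      X = h + suc b * span
      afterD : #accepted (st needL (suc (suc h)) (suc b) E) X ≡ raney q B (h + E * suc k + q)
      afterD = begin
        #accepted (st needL (suc (suc h)) (suc b) E) X
          ≡⟨ cong (#accepted (st needL (suc (suc h)) (suc b) E))
               (solve 3 (λ k h b → h :+ (con 1 :+ b) :* ((con 2 :+ k) :+ (con 2 :+ k))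
                                 := con 1 :+ (k :+ (con 1 :+ ((k :+ (con 2 :+ h)) :+ b :* ((con 2 :+ k) :+ (con 2 :+ k))))))
                      refl k h b) ⟩
        #accepted (st needL (suc (suc h)) (suc b) E) (suc (k + suc ((k + suc (suc h)) + b * span)))
          ≡⟨ #accepted-needL (suc h) b E _ ⟩
        #accepted (st free (k + suc (suc h)) b E) ((k + suc (suc h)) + b * span)
          ≡⟨ #accepted-free b (k + suc (suc h)) B E (suc-injective B+E≡b) ⟩
        raney q B (k + suc (suc h) + E * suc k)
          ≡⟨ cong (raney q B) (solve 3 (λ k h E → k :+ (con 2 :+ h) :+ E :* (con 1 :+ k)
                                               := h :+ E :* (con 1 :+ k) :+ (con 2 :+ k)) refl k h E) ⟩
        raney q B (h + E * suc k + q)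
          ∎

module BoxRecognition where

  open Words
  open BackwardReading
  open import Data.Bool using (Bool; true; false; T; if_then_else_)
  open import Data.Bool.Properties using (T-≡; T-∧)
  open import Data.Nat using (ℕ; zero; suc; _+_; _*_; _∸_; _≤_; z≤n; s≤s; NonZero)
  open import Data.Nat.Properties
  open import Data.Unit using (⊤; tt)
  open import Data.Empty using (⊥-elim)
  open import Data.Product using (∃; _×_; _,_; proj₁; proj₂)
  open import Data.List using (List; []; _∷_; _++_; [_]; length; foldr)
  open import Data.List.Properties using (foldr-++)
  open import Function using (_∘_; _⇔_; mk⇔; Equivalence)
  open Equivalence using (to; from)
  open import Relation.Nullary using (contradiction)
  open import Relation.Binary.PropositionalEquality hiding ([_])
  open import Data.Nat.Solver using (module +-*-Solver)
  open +-*-Solver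

  T-injective : ∀ {a b} → T a ⇔ T b → a ≡ b
  T-injective {false} {false} _   = refl
  T-injective {false} {true}  a⇔b = ⊥-elim (from a⇔b tt)
  T-injective {true}  {false} a⇔b = ⊥-elim (to a⇔b tt)
  T-injective {true}  {true}  _   = refl

  T-isKBoxPathWithReturns : ∀ k n j w → T (isKBoxPathWithReturns k n j w) ⇔
    (noULnorLU w ≡ true × walk 0 w ≡ true × countU w ≡ (k + 2) * n ∸ 1
     × occurrences (boxFactor k) w ≡ n × returns w ≡ j)
  T-isKBoxPathWithReturns k n j w = mk⇔ parts (λ (ok , ok-walk , semi , boxes , rets) →
    from T-∧ (from T-∧ (from T-≡ ok , from T-≡ ok-walk) ,
              from T-∧ (≡⇒≡ᵇ _ _ semi , from T-∧ (≡⇒≡ᵇ _ _ boxes , ≡⇒≡ᵇ _ _ rets))))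
    where
    parts : T (isKBoxPathWithReturns k n j w) → _
    parts isPath with to T-∧ isPath
    ... | skew , rest with to T-∧ skew | to T-∧ rest
    ... | ok , ok-walk | semi , rest′ with to T-∧ rest′
    ... | boxes , rets =
      to T-≡ ok , to T-≡ ok-walk , ≡ᵇ⇒≡ _ _ semi , ≡ᵇ⇒≡ _ _ boxes , ≡ᵇ⇒≡ _ _ rets

  module BoxPaths (k′ : ℕ) where

    k q : ℕ
    k = suc k′
    q = 2 + k

    open Automaton k using (step; run; start; accepting)

    occ : List Step → ℕ
    occ = occurrences (boxFactor k)

    occ-DsL : ∀ c w → occ (rep c D ++ L ∷ w) ≡ occ w
    occ-DsL zero    w = refl
    occ-DsL (suc c) w = occ-DsL c w

    length-DsL : ∀ c w → length w ≤ length (rep c D ++ L ∷ w)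
    length-DsL zero    w = n≤1+n _
    length-DsL (suc c) w = m≤n⇒m≤1+n (length-DsL c w)

    -- Each box U Dᵏ L supplies k + 1 down steps, and, apart from possibly the first
    -- one, is followed by a further down step (UL and LU are excluded).
    boxes-bound : ∀ F w → length w ≤ F → noULnorLU w ≡ true →
      occ w * q ≤ suc (#downs w) × (StartsDown w → occ w * q ≤ #downs w)
    boxes-bound F [] _ _ = z≤n , λ _ → z≤n
    boxes-bound (suc F) (D ∷ w) (s≤s ℓ) ok = let bound , _ = boxes-bound F w ℓ ok in
      m≤n⇒m≤1+n bound , λ _ → bound
    boxes-bound (suc F) (L ∷ w) (s≤s ℓ) ok = let bound , _ = boxes-bound F w ℓ (noULnorLU-tail L w ok) in
      m≤n⇒m≤1+n bound , λ _ → bound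
    boxes-bound (suc F) (U ∷ w) (s≤s ℓ) ok rewrite occurrences-∷ (boxFactor k) U w
      with isPrefixOf (rep k D ++ [ L ]) w in isBox
    ... | false = proj₁ (boxes-bound F w ℓ (noULnorLU-tail U w ok)) , λ ()
    ... | true with isPrefixOf-DsL k w isBox
    ... | w′ , refl = bound , λ ()
      where
      okL : noULnorLU (L ∷ w′) ≡ true
      okL = noULnorLU-dropDs k (L ∷ w′) (noULnorLU-tail U (rep k D ++ L ∷ w′) ok)
      bound′ : occ w′ * q ≤ #downs w′
      bound′ = proj₂ (boxes-bound F w′ (≤-trans (length-DsL k w′) ℓ) (noULnorLU-tail L w′ okL))
                     (noULnorLU-L⇒StartsDown w′ okL)
      bound : (1 + occ (rep k D ++ L ∷ w′)) * q ≤ suc (#downs (rep k D ++ L ∷ w′))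
      bound rewrite occ-DsL k w′ | #downs-DsL k w′ =
        subst (q + occ w′ * q ≤_)
              (solve 2 (λ k d → con 2 :+ k :+ d := con 1 :+ (k :+ (con 1 :+ d))) refl k (#downs w′))
              (+-monoʳ-≤ q bound′)

    tight⇒StartsD : ∀ w → noULnorLU (L ∷ w) ≡ true → occ w * q ≡ #downs w → StartsD w
    tight⇒StartsD []      _   _     = tt
    tight⇒StartsD (D ∷ w) _   _     = tt
    tight⇒StartsD (L ∷ w) okL tight = contradiction (subst (_≤ #downs w) tight bound) 1+n≰n
      where
      ok : noULnorLU (L ∷ w) ≡ true
      ok = noULnorLU-tail L (L ∷ w) okL
      bound : occ w * q ≤ #downs w
      bound = proj₂ (boxes-bound _ w ≤-refl (noULnorLU-tail L w ok)) (noULnorLU-L⇒StartsDown w ok)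

    run-Ds : ∀ c c′ h b e → foldr step (st (inBox (c + c′)) h b e) (rep c D) ≡ st (inBox c′) (c + h) b e
    run-Ds zero    c′ h b e = refl
    run-Ds (suc c) c′ h b e =
      cong (step D) (trans (cong (λ c″ → foldr step (st (inBox c″) h b e) (rep c D)) (sym (+-suc c c′)))
                           (run-Ds c (suc c′) h b e))

    run-DsL : ∀ σ w h b e → run σ w ≡ st needL h (suc b) (returnAt h + e) →
      run σ (rep k D ++ L ∷ w) ≡ st (inBox 0) (k + suc h) (suc b) e
    run-DsL σ w h b e reachesL = begin
      run σ (rep k D ++ L ∷ w)
        ≡⟨ foldr-++ step σ (rep k D) (L ∷ w) ⟩
      foldr step (step L (run σ w)) (rep k D)
        ≡⟨ cong (λ σ′ → foldr step (step L σ′) (rep k D)) reachesL ⟩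
      foldr step (step L (st needL h (suc b) (returnAt h + e))) (rep k D)
        ≡⟨ cong (λ σ′ → foldr step σ′ (rep k D)) (stepL h) ⟩
      foldr step (st (inBox k) (suc h) (suc b) e) (rep k D)
        ≡⟨ cong (λ c → foldr step (st (inBox c) (suc h) (suc b) e) (rep k D)) (+-identityʳ k) ⟨
      foldr step (st (inBox (k + 0)) (suc h) (suc b) e) (rep k D)
        ≡⟨ run-Ds k 0 (suc h) (suc b) e ⟩
      st (inBox 0) (k + suc h) (suc b) e
        ∎
      where
      open ≡-Reasoning
      stepL : ∀ h → step L (st needL h (suc b) (returnAt h + e)) ≡ st (inBox k) (suc h) (suc b) e
      stepL zero    = refl
      stepL (suc h) = refl

    -- The fuel F bounds the length, since after a box
    -- the recursion continues on a suffix that is not a subterm.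
    mutual
      run-free : ∀ F w h → length w ≤ F → noULnorLU w ≡ true → walk h w ≡ true →
        occ w * q ≡ suc (#downs w) →
        ∀ b e → run (start (b + occ w) (e + returnsFrom h w)) w ≡ st free h b e
      run-free (suc F) (D ∷ w) (suc h) (s≤s ℓ) ok _ tight b e =
        contradiction (subst (_≤ suc (#downs w)) tight (proj₁ (boxes-bound F w ℓ ok))) 1+n≰n
      run-free (suc F) (L ∷ w) (suc h) (s≤s ℓ) ok _ tight b e =
        contradiction (subst (_≤ suc (#downs w)) tight (proj₁ (boxes-bound F w ℓ (noULnorLU-tail L w ok)))) 1+n≰n
      run-free (suc F) (U ∷ w) h (s≤s ℓ) ok ok-walk tight b e rewrite occurrences-∷ (boxFactor k) U w
        with isPrefixOf (rep k D ++ [ L ]) w in isBox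
      ... | false = cong (step U)
        (run-free F w (suc h) ℓ (noULnorLU-tail U w ok) (trans (sym (walk-U h w)) ok-walk) tight b e)
      ... | true with isPrefixOf-DsL k w isBox
      ... | w′ , refl with walk-DsL k (suc h) w′ (trans (sym (walk-U h _)) ok-walk)
      ... | h′ , h≡ , ok-walk′ with suc-injective h≡
      ... | refl = cong (step U) (run-DsL (start (b + (1 + occ W)) (e + returnsFrom (k + suc h′) W)) w′ h′ b e
                                    (trans (cong (λ σ → run σ w′) budgets) afterBox))
        where
        W = rep k D ++ L ∷ w′
        okL : noULnorLU (L ∷ w′) ≡ true
        okL = noULnorLU-dropDs k (L ∷ w′) (noULnorLU-tail U W ok)
        tight′ : occ w′ * q ≡ #downs w′
        tight′ = +-cancelˡ-≡ q _ _
          (trans (subst₂ (λ a d → (1 + a) * q ≡ suc d) (occ-DsL k w′) (#downs-DsL k w′) tight)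
                 (solve 2 (λ k d → con 1 :+ (k :+ (con 1 :+ d)) := con 2 :+ k :+ d) refl k (#downs w′)))
        budgets : start (b + (1 + occ W)) (e + returnsFrom (k + suc h′) W)
                ≡ start (suc b + occ w′) ((returnAt h′ + e) + returnsFrom h′ w′)
        budgets rewrite occ-DsL k w′ | returnsFrom-DsL k h′ w′ =
          cong₂ start (+-suc b (occ w′))
            (trans (sym (+-assoc e (returnAt h′) _)) (cong (_+ returnsFrom h′ w′) (+-comm e (returnAt h′))))
        afterBox : run (start (suc b + occ w′) ((returnAt h′ + e) + returnsFrom h′ w′)) w′
                 ≡ st needL h′ (suc b) (returnAt h′ + e)
        afterBox = run-needL F w′ h′ (≤-trans (length-DsL k w′) ℓ) (noULnorLU-tail L w′ okL) ok-walk′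
                     tight′ (tight⇒StartsD w′ okL tight′) (suc b) (returnAt h′ + e)

      run-needL : ∀ F w h → length w ≤ F → noULnorLU w ≡ true → walk h w ≡ true →
        occ w * q ≡ #downs w → StartsD w →
        ∀ b e → run (start (b + occ w) (e + returnsFrom h w)) w ≡ st needL h b e
      run-needL F [] zero _ _ _ _ _ b e = cong₂ start (+-identityʳ b) (+-identityʳ e)
      run-needL (suc F) (D ∷ w) (suc zero) (s≤s ℓ) ok ok-walk tight _ b e = cong (step D)
        (trans (cong (λ r → run (start (b + occ w) r) w) (+-suc e _)) (run-free F w zero ℓ ok ok-walk tight b (suc e)))
      run-needL (suc F) (D ∷ w) (suc (suc h)) (s≤s ℓ) ok ok-walk tight _ b e =
        cong (step D) (run-free F w (suc h) ℓ ok ok-walk tight b e)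

    module Soundness (n j : ℕ) where

      -- countU w + h is q·(boxes of w) − 1 once a whole number of boxes has been
      -- read; for the whole path (h = 0) this is the semilength (k + 2) n − 1.
      -- Inside a box the height stays positive, so its D steps are not returns.
      PhaseInvariant : Phase → List Step → ℕ → Set
      PhaseInvariant free      w h = StartsU w × suc (countU w + h) ≡ occ w * q
      PhaseInvariant needL     w h = StartsD w × countU w + h ≡ occ w * q
      PhaseInvariant (inBox c) w h = ∃ λ d → d + c ≡ k × isPrefixOf (rep d D ++ [ L ]) w ≡ true
                                              × countU w + h ≡ occ w * q + suc d × NonZero h

      Invariant : State → List Step → Set
      Invariant dead           w = ⊤
      Invariant (st φ h b e) w = walk h w ≡ true × noULnorLU w ≡ true
                                 × b + occ w ≡ n × e + returnsFrom h w ≡ j × PhaseInvariant φ w h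

      noULnorLU-L∷ : ∀ w → StartsD w → noULnorLU w ≡ true → noULnorLU (L ∷ w) ≡ true
      noULnorLU-L∷ []      _ _  = refl
      noULnorLU-L∷ (D ∷ w) _ ok = ok

      step-invariant : ∀ x σ w → Invariant σ w → Invariant (step x σ) (x ∷ w)
      step-invariant _ dead w _ = tt
      step-invariant U (st free zero b e) w _ = tt
      step-invariant U (st free (suc h) b e) (U ∷ w) (wk , ok , bs , rs , _ , us) =
        trans (walk-U h _) wk , ok , bs , rs , tt , trans (cong suc (sym (+-suc (countU (U ∷ w)) h))) us
      step-invariant D (st free zero b zero) w _ = tt
      step-invariant D (st free zero b (suc e)) w (wk , ok , bs , rs , _ , us) =
        wk , ok , bs , trans (+-suc e _) rs , tt ,
        trans (trans (+-comm (countU w) 1) (cong suc (sym (+-identityʳ (countU w))))) us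
      step-invariant D (st free (suc h) b e) w (wk , ok , bs , rs , _ , us) =
        wk , ok , bs , rs , tt , trans (+-suc (countU w) (suc h)) us
      step-invariant L (st free h b e) w _ = tt
      step-invariant U (st needL h b e) w _ = tt
      step-invariant D (st needL h b e) w _ = tt
      step-invariant L (st needL zero b zero) w _ = tt
      step-invariant L (st needL zero b (suc e)) w (wk , ok , bs , rs , startsD , us) =
        wk , noULnorLU-L∷ w startsD ok , bs , trans (+-suc e _) rs ,
        (0 , refl , refl , cong (_+ 1) (trans (sym (+-identityʳ (countU w))) us) , _)
      step-invariant L (st needL (suc h) b e) w (wk , ok , bs , rs , startsD , us) =
        wk , noULnorLU-L∷ w startsD ok , bs , rs ,
        (0 , refl , refl , trans (+-suc (countU w) (suc h)) (trans (cong suc us) (+-comm 1 _)) , _)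
      step-invariant D (st (inBox zero) h b e) w _ = tt
      step-invariant D (st (inBox (suc c)) (suc h) b e) w (wk , ok , bs , rs , (d , d+c , isBox , us , _)) =
        wk , ok , bs , rs ,
        (suc d , trans (sym (+-suc d c)) d+c , isBox ,
         trans (+-suc (countU w) (suc h)) (trans (cong suc us) (sym (+-suc _ (suc d)))) , _)
      step-invariant U (st (inBox zero) zero b e) w _ = tt
      step-invariant U (st (inBox zero) (suc h) zero e) w _ = tt
      step-invariant U (st (inBox zero) (suc h) (suc b) e) w (wk , ok , bs , rs , (d , d+0 , isBox , us , _))
        with trans (sym (+-identityʳ d)) d+0
      ... | refl with isPrefixOf-DsL k w isBox
      ... | w′ , refl = trans (walk-U h _) wk , ok , boxes , rs , tt , ups
        where
        W = rep k D ++ L ∷ w′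
        occ-U∷ : occ (U ∷ W) ≡ 1 + occ W
        occ-U∷ = trans (occurrences-∷ (boxFactor k) U W) (cong (λ p → (if p then 1 else 0) + occ W) isBox)
        boxes : b + occ (U ∷ W) ≡ n
        boxes = trans (cong (b +_) occ-U∷) (trans (+-suc b _) bs)
        ups : suc (countU (U ∷ W) + h) ≡ occ (U ∷ W) * q
        ups rewrite occ-U∷ = trans (cong suc (sym (+-suc (countU W) h)))
          (trans (cong suc us)
                 (solve 2 (λ a k′ → con 1 :+ (a :+ (con 2 :+ k′)) := (con 3 :+ k′) :+ a) refl (occ W * q) k′))
      step-invariant U (st (inBox (suc c)) h b e) w _ = tt
      step-invariant L (st (inBox c) h b e) w _ = tt

      run-invariant : ∀ w → Invariant (run (start n j) w) w
      run-invariant []      = refl , refl , +-identityʳ n , +-identityʳ j , tt , refl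
      run-invariant (x ∷ w) = step-invariant x (run (start n j) w) w (run-invariant w)

    module _ (n′ j : ℕ) where

      private
        n : ℕ
        n = suc n′

        semilength : suc ((k + 2) * n ∸ 1) ≡ n * q
        semilength = solve 2 (λ k′ n′ → con 1 :+ (n′ :+ (k′ :+ con 2) :* (con 1 :+ n′))
                                      := (con 1 :+ n′) :* (con 3 :+ k′)) refl k′ n′

      open Soundness n j

      accepted⇒boxPath : ∀ w → T (accepting (run (start n j) w)) → T (isKBoxPathWithReturns k n j w)
      accepted⇒boxPath w acc with run (start n j) w | run-invariant w
      ... | st free zero zero zero | ok-walk , ok , occ≡n , ret≡j , _ , ups =
        from (T-isKBoxPathWithReturns k n j w) (ok , ok-walk , semi , occ≡n , ret≡j)
        where
        semi : countU w ≡ (k + 2) * n ∸ 1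
        semi = suc-injective (begin
          suc (countU w)          ≡⟨ cong suc (+-identityʳ (countU w)) ⟨
          suc (countU w + 0)      ≡⟨ ups ⟩
          occ w * q               ≡⟨ cong (_* q) occ≡n ⟩
          n * q                   ≡⟨ semilength ⟨
          suc ((k + 2) * n ∸ 1)   ∎)
          where open ≡-Reasoning

      boxPath⇒accepted : ∀ w → T (isKBoxPathWithReturns k n j w) → T (accepting (run (start n j) w))
      boxPath⇒accepted w isPath with to (T-isKBoxPathWithReturns k n j w) isPath
      ... | ok , ok-walk , semi , occ≡n , ret≡j = subst (T ∘ accepting) (sym reachesEnd) tt
        where
        tight : occ w * q ≡ suc (#downs w)
        tight = begin
          occ w * q                ≡⟨ cong (_* q) occ≡n ⟩
          n * q                    ≡⟨ semilength ⟨
          suc ((k + 2) * n ∸ 1)    ≡⟨ cong suc semi ⟨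
          suc (countU w)           ≡⟨ cong suc (+-identityʳ (countU w)) ⟨
          suc (countU w + 0)       ≡⟨ cong suc (walk-balance 0 w ok-walk) ⟩
          suc (#downs w)           ∎
          where open ≡-Reasoning
        reachesEnd : run (start n j) w ≡ st free 0 0 0
        reachesEnd = subst₂ (λ b e → run (start b e) w ≡ st free 0 0 0) occ≡n ret≡j
                       (run-free (length w) w 0 ≤-refl ok ok-walk tight 0 0)

      boxPath≡accepting : ∀ w → isKBoxPathWithReturns k n j w ≡ accepting (run (start n j) w)
      boxPath≡accepting w = T-injective (mk⇔ (boxPath⇒accepted w) (accepted⇒boxPath w))

module BoxPathCount where

  open WordCount
  open Raney
  open BackwardReading
  open BoxRecognition
  open import Data.Nat using (ℕ; suc; _+_; _*_; _∸_; _<_; s≤s)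
  open import Data.Nat.Properties using (+-identityʳ)
  open import Relation.Binary.PropositionalEquality
  open import Data.Nat.Solver using (module +-*-Solver)
  open +-*-Solver
  open ≡-Reasoning

  module _ (k′ : ℕ) where

    private
      k : ℕ
      k = suc k′

    open Automaton k

    fBox≡#accepted : ∀ n′ j → fBox k (suc n′) j ≡ #accepted (start (suc n′) j) (2 * ((k + 2) * suc n′ ∸ 1))
    fBox≡#accepted n′ j =
      trans (length-filter _ (words ℓ))
        (trans (#words-cong (BoxPaths.boxPath≡accepting k′ n′ j) ℓ) (#words-accepting-run ℓ _))
      where ℓ = 2 * ((k + 2) * suc n′ ∸ 1)

    fBox-raney : ∀ n′ j′ B → n′ ≡ B + j′ → fBox k (suc n′) (suc j′) ≡ raney q B (k + j′ * suc k)
    fBox-raney n′ j′ B n′≡B+j′ = begin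
      fBox k (suc n′) (suc j′)
        ≡⟨ fBox≡#accepted n′ (suc j′) ⟩
      #accepted (start (suc n′) (suc j′)) (2 * ((k + 2) * suc n′ ∸ 1))
        ≡⟨ cong (#accepted (start (suc n′) (suc j′)))
             (solve 2 (λ k′ n′ → con 2 :* (n′ :+ (k′ :+ con 2) :* (con 1 :+ n′))
                               := con 1 :+ ((con 1 :+ k′) :+ (con 1 :+ (((con 1 :+ k′) :+ con 0)
                                    :+ n′ :* ((con 3 :+ k′) :+ (con 3 :+ k′)))))) refl k′ n′) ⟩
      #accepted (start (suc n′) (suc j′)) (suc (k + suc m))
        ≡⟨ cong (λ z → z + z + #accepted (st (inBox k) 1 (suc n′) j′) (k + suc m))
                (#accepted-dead (k + suc m)) ⟩
      #accepted (st (inBox k) 1 (suc n′) j′) (k + suc m)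
        ≡⟨ #accepted-inBox k 0 n′ j′ m ⟩
      #accepted (st free (k + 0) n′ j′) m
        ≡⟨ #accepted-free n′ (k + 0) B j′ (sym n′≡B+j′) ⟩
      raney q B ((k + 0) + j′ * suc k)
        ≡⟨ cong (λ h → raney q B (h + j′ * suc k)) (+-identityʳ k) ⟩
      raney q B (k + j′ * suc k)
        ∎
      where m = (k + 0) + n′ * span

    fBox-zero : ∀ n′ j′ → n′ < j′ → fBox k (suc n′) (suc j′) ≡ 0
    fBox-zero n′ j′ n′<j′ =
      trans (fBox≡#accepted n′ (suc j′))
            (#accepted-doomed (2 * ((k + 2) * suc n′ ∸ 1)) (start (suc n′) (suc j′)) (s≤s n′<j′))

module Series where

  open Raney using (sumToℕ)
  open import Data.Nat as ℕ using (ℕ; zero; suc; _∸_; _≤_; _<_; z≤n; s≤s)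
  import Data.Nat.Properties as ℕ
  import Data.Integer as ℤ
  import Data.Integer.Properties as ℤ
  open import Data.Rational using (ℚ; 0ℚ; 1ℚ; _+_; _*_; _/_; toℚᵘ)
  open import Data.Rational.Properties
    using (toℚᵘ-injective; toℚᵘ-homo-+; toℚᵘ-homo-*; toℚᵘ-fromℚᵘ; fromℚᵘ-cong;
           +-assoc; +-identityˡ; +-identityʳ; *-identityˡ; *-zeroˡ; *-zeroʳ)
  import Data.Rational.Unnormalised as ℚᵘ
  import Data.Rational.Unnormalised.Properties as ℚᵘ
  open import Relation.Binary.PropositionalEquality
  open import Relation.Nullary using (yes; no; contradiction)
  open import Function using (_∘_)
  open import Level using (0ℓ)
  open import Relation.Binary.Bundles using (Setoid)
  import Relation.Binary.Reasoning.Setoid as SetoidReasoning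

  fromℕ : ℕ → ℚ
  fromℕ a = ℤ.+ a / 1

  private
    fromℕᵘ : ℕ → ℚᵘ.ℚᵘ
    fromℕᵘ a = ℚᵘ.mkℚᵘ (ℤ.+ a) 0

    toℚᵘ-fromℕ : ∀ a → toℚᵘ (fromℕ a) ℚᵘ.≃ fromℕᵘ a
    toℚᵘ-fromℕ a = toℚᵘ-fromℚᵘ (fromℕᵘ a)

  fromℕ-+ : ∀ a b → fromℕ a + fromℕ b ≡ fromℕ (a ℕ.+ b)
  fromℕ-+ a b = toℚᵘ-injective (ℚᵘ.≃-trans (toℚᵘ-homo-+ (fromℕ a) (fromℕ b))
    (ℚᵘ.≃-trans (ℚᵘ.+-cong (toℚᵘ-fromℕ a) (toℚᵘ-fromℕ b))
    (ℚᵘ.≃-trans (ℚᵘ.*≡* (cong (ℤ._* ℤ.+ 1)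
                  (trans (cong₂ ℤ._+_ (ℤ.*-identityʳ (ℤ.+ a)) (ℤ.*-identityʳ (ℤ.+ b))) (ℤ.pos-+ a b))))
                (ℚᵘ.≃-sym (toℚᵘ-fromℕ (a ℕ.+ b))))))

  fromℕ-* : ∀ a b → fromℕ a * fromℕ b ≡ fromℕ (a ℕ.* b)
  fromℕ-* a b = toℚᵘ-injective (ℚᵘ.≃-trans (toℚᵘ-homo-* (fromℕ a) (fromℕ b))
    (ℚᵘ.≃-trans (ℚᵘ.*-cong (toℚᵘ-fromℕ a) (toℚᵘ-fromℕ b))
    (ℚᵘ.≃-trans (ℚᵘ.*≡* (cong (ℤ._* ℤ.+ 1) (sym (ℤ.pos-* a b))))
                (ℚᵘ.≃-sym (toℚᵘ-fromℕ (a ℕ.* b))))))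

  fromℕ-sumToℕ : ∀ n f → sumTo n (fromℕ ∘ f) ≡ fromℕ (sumToℕ n f)
  fromℕ-sumToℕ zero    f = refl
  fromℕ-sumToℕ (suc n) f =
    trans (cong (_+ fromℕ (f (suc n))) (fromℕ-sumToℕ n f)) (fromℕ-+ (sumToℕ n f) (f (suc n)))

  [d*a]/d≡fromℕ : ∀ d-1 a → ℤ.+ (suc d-1 ℕ.* a) / suc d-1 ≡ fromℕ a
  [d*a]/d≡fromℕ d-1 a =
    fromℚᵘ-cong {ℚᵘ.mkℚᵘ (ℤ.+ (suc d-1 ℕ.* a)) d-1} {fromℕᵘ a} (ℚᵘ.*≡* (begin
    ℤ.+ (suc d-1 ℕ.* a) ℤ.* ℤ.+ 1  ≡⟨ ℤ.*-identityʳ _ ⟩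
    ℤ.+ (suc d-1 ℕ.* a)            ≡⟨ cong ℤ.+_ (ℕ.*-comm (suc d-1) a) ⟩
    ℤ.+ (a ℕ.* suc d-1)            ≡⟨ ℤ.pos-* a (suc d-1) ⟩
    ℤ.+ a ℤ.* ℤ.+ suc d-1          ∎))
    where open ≡-Reasoning

  sumTo-cong≤ : ∀ m {f g} → (∀ x → x ≤ m → f x ≡ g x) → sumTo m f ≡ sumTo m g
  sumTo-cong≤ zero    f≡g = f≡g 0 z≤n
  sumTo-cong≤ (suc m) f≡g =
    cong₂ _+_ (sumTo-cong≤ m (λ x x≤m → f≡g x (ℕ.m≤n⇒m≤1+n x≤m))) (f≡g (suc m) ℕ.≤-refl)

  sumTo-cong : ∀ m {f g} → (∀ x → f x ≡ g x) → sumTo m f ≡ sumTo m g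
  sumTo-cong m f≡g = sumTo-cong≤ m (λ x _ → f≡g x)

  sumTo-zero≤ : ∀ m {f} → (∀ x → x ≤ m → f x ≡ 0ℚ) → sumTo m f ≡ 0ℚ
  sumTo-zero≤ m f≡0 = trans (sumTo-cong≤ m f≡0) (sumTo-const0 m)
    where
    sumTo-const0 : ∀ m → sumTo m (λ _ → 0ℚ) ≡ 0ℚ
    sumTo-const0 zero    = refl
    sumTo-const0 (suc m) = cong (_+ 0ℚ) (sumTo-const0 m)

  sumTo-zero : ∀ m {f} → (∀ x → f x ≡ 0ℚ) → sumTo m f ≡ 0ℚ
  sumTo-zero m f≡0 = sumTo-zero≤ m (λ x _ → f≡0 x)

  sumTo-unfoldˡ : ∀ m f → sumTo (suc m) f ≡ f 0 + sumTo m (λ x → f (suc x))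
  sumTo-unfoldˡ zero    f = refl
  sumTo-unfoldˡ (suc m) f = trans (cong (_+ f (suc (suc m))) (sumTo-unfoldˡ m f)) (+-assoc (f 0) _ _)

  sumTo-single : ∀ m a {f} → a ≤ m → (∀ x → x ≢ a → f x ≡ 0ℚ) → sumTo m f ≡ f a
  sumTo-single zero    zero    _   _    = refl
  sumTo-single (suc m) a {f} a≤m f≡0 with a ℕ.≟ suc m
  ... | yes refl =
    trans (cong (_+ f (suc m)) (sumTo-zero≤ m (λ x x≤m → f≡0 x λ { refl → ℕ.1+n≰n x≤m }))) (+-identityˡ _)
  ... | no  a≢m  =
    trans (cong₂ _+_ (sumTo-single m a (ℕ.≤-pred (ℕ.≤∧≢⇒< a≤m a≢m)) f≡0) (f≡0 (suc m) (a≢m ∘ sym)))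
          (+-identityʳ _)

  ≈ₚ-refl : ∀ {A} → A ≈ₚ A
  ≈ₚ-refl i n = refl

  ≈ₚ-sym : ∀ {A B} → A ≈ₚ B → B ≈ₚ A
  ≈ₚ-sym A≈B i n = sym (A≈B i n)

  ≈ₚ-trans : ∀ {A B C} → A ≈ₚ B → B ≈ₚ C → A ≈ₚ C
  ≈ₚ-trans A≈B B≈C i n = trans (A≈B i n) (B≈C i n)

  ≈ₚ-setoid : Setoid 0ℓ 0ℓ
  ≈ₚ-setoid = record
    { Carrier       = PS
    ; _≈_           = _≈ₚ_
    ; isEquivalence = record { refl = ≈ₚ-refl ; sym = ≈ₚ-sym ; trans = ≈ₚ-trans }
    }

  ⋆-cong : ∀ {A A′ B B′} → A ≈ₚ A′ → B ≈ₚ B′ → A ⋆ B ≈ₚ A′ ⋆ B′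
  ⋆-cong A≈A′ B≈B′ i n =
    sumTo-cong i λ a → sumTo-cong n λ b → cong₂ _*_ (A≈A′ a b) (B≈B′ (i ∸ a) (n ∸ b))

  shiftT : PS → PS
  shiftT A zero    n = 0ℚ
  shiftT A (suc i) n = A i n

  shiftX : PS → PS
  shiftX A i zero    = 0ℚ
  shiftX A i (suc n) = A i n

  inX : (ℕ → ℚ) → PS
  inX P zero    n = P n
  inX P (suc i) n = 0ℚ

  shiftT-cong : ∀ {A B} → A ≈ₚ B → shiftT A ≈ₚ shiftT B
  shiftT-cong A≈B zero    n = refl
  shiftT-cong A≈B (suc i) n = A≈B i n

  shiftX-cong : ∀ {A B} → A ≈ₚ B → shiftX A ≈ₚ shiftX B
  shiftX-cong A≈B i zero    = refl
  shiftX-cong A≈B i (suc n) = A≈B i n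

  inX-cong : ∀ {P Q} → (∀ n → P n ≡ Q n) → inX P ≈ₚ inX Q
  inX-cong P≡Q zero    n = P≡Q n
  inX-cong P≡Q (suc i) n = refl

  shiftX-shiftT : ∀ A → shiftX (shiftT A) ≈ₚ shiftT (shiftX A)
  shiftX-shiftT A zero    zero    = refl
  shiftX-shiftT A zero    (suc n) = refl
  shiftX-shiftT A (suc i) zero    = refl
  shiftX-shiftT A (suc i) (suc n) = refl

  private
    sumTo-0* : ∀ n (g : ℕ → ℚ) → sumTo n (λ b → 0ℚ * g b) ≡ 0ℚ
    sumTo-0* n g = sumTo-zero n (λ b → *-zeroˡ (g b))

  shiftT-⋆ : ∀ A B → shiftT A ⋆ B ≈ₚ shiftT (A ⋆ B)
  shiftT-⋆ A B zero    n = sumTo-0* n (λ b → B 0 (n ∸ b))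
  shiftT-⋆ A B (suc i) n =
    trans (sumTo-unfoldˡ i (λ a → sumTo n (λ b → shiftT A a b * B (suc i ∸ a) (n ∸ b))))
          (trans (cong (_+ (A ⋆ B) i n) (sumTo-0* n (λ b → B (suc i) (n ∸ b)))) (+-identityˡ _))

  shiftX-⋆ : ∀ A B → shiftX A ⋆ B ≈ₚ shiftX (A ⋆ B)
  shiftX-⋆ A B i zero    = sumTo-zero i (λ a → *-zeroˡ (B (i ∸ a) 0))
  shiftX-⋆ A B i (suc n) = sumTo-cong i λ a →
    trans (sumTo-unfoldˡ n (λ b → shiftX A a b * B (i ∸ a) (suc n ∸ b)))
          (trans (cong (_+ sumTo n (λ b → A a b * B (i ∸ a) (n ∸ b))) (*-zeroˡ (B (i ∸ a) (suc n))))
                 (+-identityˡ _))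

  inX-⋆-coeff : ∀ P C i n → (inX P ⋆ C) i n ≡ sumTo n (λ b → P b * C i (n ∸ b))
  inX-⋆-coeff P C zero    n = refl
  inX-⋆-coeff P C (suc i) n =
    trans (sumTo-unfoldˡ i (λ a → sumTo n (λ b → inX P a b * C (suc i ∸ a) (n ∸ b))))
          (trans (cong (sumTo n (λ b → P b * C (suc i) (n ∸ b)) +_)
                       (sumTo-zero i (λ a → sumTo-0* n (λ b → C (i ∸ a) (n ∸ b)))))
                 (+-identityʳ _))

  inX-⋆-shiftT : ∀ P C → inX P ⋆ shiftT C ≈ₚ shiftT (inX P ⋆ C)
  inX-⋆-shiftT P C zero    n = trans (inX-⋆-coeff P (shiftT C) 0 n) (sumTo-zero n (λ b → *-zeroʳ (P b)))
  inX-⋆-shiftT P C (suc i) n = trans (inX-⋆-coeff P (shiftT C) (suc i) n) (sym (inX-⋆-coeff P C i n))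

  inX-⋆-shiftX : ∀ P C → inX P ⋆ shiftX C ≈ₚ shiftX (inX P ⋆ C)
  inX-⋆-shiftX P C i zero    = trans (inX-⋆-coeff P (shiftX C) i 0) (*-zeroʳ (P 0))
  inX-⋆-shiftX P C i (suc n) = begin
    (inX P ⋆ shiftX C) i (suc n)
      ≡⟨ inX-⋆-coeff P (shiftX C) i (suc n) ⟩
    sumTo n (λ b → P b * shiftX C i (suc n ∸ b)) + P (suc n) * shiftX C i (suc n ∸ suc n)
      ≡⟨ cong₂ _+_ (sumTo-cong≤ n λ b b≤n → cong (λ z → P b * shiftX C i z) (ℕ.+-∸-assoc 1 b≤n))
                   (cong (λ z → P (suc n) * shiftX C i z) (ℕ.n∸n≡0 n)) ⟩
    sumTo n (λ b → P b * C i (n ∸ b)) + P (suc n) * 0ℚ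
      ≡⟨ cong (sumTo n (λ b → P b * C i (n ∸ b)) +_) (*-zeroʳ (P (suc n))) ⟩
    sumTo n (λ b → P b * C i (n ∸ b)) + 0ℚ
      ≡⟨ +-identityʳ _ ⟩
    sumTo n (λ b → P b * C i (n ∸ b))
      ≡⟨ inX-⋆-coeff P C i n ⟨
    (inX P ⋆ C) i n
      ∎
    where open ≡-Reasoning

  convolution : (ℕ → ℚ) → (ℕ → ℚ) → ℕ → ℚ
  convolution P Q n = sumTo n (λ b → P b * Q (n ∸ b))

  inX-⋆-inX : ∀ P Q → inX P ⋆ inX Q ≈ₚ inX (convolution P Q)
  inX-⋆-inX P Q zero    n = refl
  inX-⋆-inX P Q (suc i) n = trans (inX-⋆-coeff P (inX Q) (suc i) n) (sumTo-zero n (λ b → *-zeroʳ (P b)))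

  δ₀ : ℕ → ℚ
  δ₀ zero    = 1ℚ
  δ₀ (suc _) = 0ℚ

  oneₚ≈inX-δ₀ : oneₚ ≈ₚ inX δ₀
  oneₚ≈inX-δ₀ zero    zero    = refl
  oneₚ≈inX-δ₀ zero    (suc n) = refl
  oneₚ≈inX-δ₀ (suc i) zero    = refl
  oneₚ≈inX-δ₀ (suc i) (suc n) = refl

  oneₚ-⋆ : ∀ C → oneₚ ⋆ C ≈ₚ C
  oneₚ-⋆ C i n =
    trans (⋆-cong oneₚ≈inX-δ₀ (≈ₚ-refl {C}) i n) (trans (inX-⋆-coeff δ₀ C i n) (δ₀-convolution n))
    where
    δ₀-convolution : ∀ n → sumTo n (λ b → δ₀ b * C i (n ∸ b)) ≡ C i n
    δ₀-convolution zero    = *-identityˡ _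
    δ₀-convolution (suc n) =
      trans (sumTo-unfoldˡ n (λ b → δ₀ b * C i (suc n ∸ b)))
            (trans (cong₂ _+_ (*-identityˡ (C i (suc n))) (sumTo-0* n (λ b → C i (n ∸ b)))) (+-identityʳ _))

  tₚ⋆xₚ⋆ : ∀ A → tₚ ⋆ xₚ ⋆ A ≈ₚ shiftT (shiftX A)
  tₚ⋆xₚ⋆ A = begin
    tₚ ⋆ xₚ ⋆ A
      ≈⟨ ⋆-cong (⋆-cong tₚ≈ xₚ≈) (≈ₚ-refl {A}) ⟩
    shiftT oneₚ ⋆ shiftX oneₚ ⋆ A
      ≈⟨ ⋆-cong (≈ₚ-trans (shiftT-⋆ oneₚ (shiftX oneₚ)) (shiftT-cong (oneₚ-⋆ (shiftX oneₚ)))) (≈ₚ-refl {A}) ⟩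
    shiftT (shiftX oneₚ) ⋆ A
      ≈⟨ ≈ₚ-trans (shiftT-⋆ (shiftX oneₚ) A) (shiftT-cong (shiftX-⋆ oneₚ A)) ⟩
    shiftT (shiftX (oneₚ ⋆ A))
      ≈⟨ shiftT-cong (shiftX-cong (oneₚ-⋆ A)) ⟩
    shiftT (shiftX A)
      ∎
    where
    open SetoidReasoning ≈ₚ-setoid
    tₚ≈ : tₚ ≈ₚ shiftT oneₚ
    tₚ≈ zero          n       = refl
    tₚ≈ (suc zero)    zero    = refl
    tₚ≈ (suc zero)    (suc n) = refl
    tₚ≈ (suc (suc i)) n       = refl
    xₚ≈ : xₚ ≈ₚ shiftX oneₚ
    xₚ≈ zero    zero          = refl
    xₚ≈ zero    (suc zero)    = refl
    xₚ≈ zero    (suc (suc n)) = refl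
    xₚ≈ (suc i) zero          = refl
    xₚ≈ (suc i) (suc n)       = refl

  shiftTⁿ shiftXⁿ : ℕ → PS → PS
  shiftTⁿ zero    A = A
  shiftTⁿ (suc m) A = shiftT (shiftTⁿ m A)
  shiftXⁿ zero    A = A
  shiftXⁿ (suc m) A = shiftX (shiftXⁿ m A)

  shiftTⁿ-cong : ∀ m {A B} → A ≈ₚ B → shiftTⁿ m A ≈ₚ shiftTⁿ m B
  shiftTⁿ-cong zero    A≈B = A≈B
  shiftTⁿ-cong (suc m) A≈B = shiftT-cong (shiftTⁿ-cong m A≈B)

  shiftXⁿ-cong : ∀ m {A B} → A ≈ₚ B → shiftXⁿ m A ≈ₚ shiftXⁿ m B
  shiftXⁿ-cong zero    A≈B = A≈B
  shiftXⁿ-cong (suc m) A≈B = shiftX-cong (shiftXⁿ-cong m A≈B)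

  shiftTⁿ-⋆ : ∀ m A B → shiftTⁿ m A ⋆ B ≈ₚ shiftTⁿ m (A ⋆ B)
  shiftTⁿ-⋆ zero    A B = ≈ₚ-refl
  shiftTⁿ-⋆ (suc m) A B = ≈ₚ-trans (shiftT-⋆ (shiftTⁿ m A) B) (shiftT-cong (shiftTⁿ-⋆ m A B))

  shiftXⁿ-⋆ : ∀ m A B → shiftXⁿ m A ⋆ B ≈ₚ shiftXⁿ m (A ⋆ B)
  shiftXⁿ-⋆ zero    A B = ≈ₚ-refl
  shiftXⁿ-⋆ (suc m) A B = ≈ₚ-trans (shiftX-⋆ (shiftXⁿ m A) B) (shiftX-cong (shiftXⁿ-⋆ m A B))

  inX-⋆-shiftXⁿ : ∀ m P C → inX P ⋆ shiftXⁿ m C ≈ₚ shiftXⁿ m (inX P ⋆ C)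
  inX-⋆-shiftXⁿ zero    P C = ≈ₚ-refl
  inX-⋆-shiftXⁿ (suc m) P C = ≈ₚ-trans (inX-⋆-shiftX P (shiftXⁿ m C)) (shiftX-cong (inX-⋆-shiftXⁿ m P C))

  shiftTⁿ-shiftT : ∀ m A → shiftTⁿ m (shiftT A) ≈ₚ shiftT (shiftTⁿ m A)
  shiftTⁿ-shiftT zero    A = ≈ₚ-refl
  shiftTⁿ-shiftT (suc m) A = shiftT-cong (shiftTⁿ-shiftT m A)

  shiftXⁿ-shiftX : ∀ m A → shiftXⁿ m (shiftX A) ≈ₚ shiftX (shiftXⁿ m A)
  shiftXⁿ-shiftX zero    A = ≈ₚ-refl
  shiftXⁿ-shiftX (suc m) A = shiftX-cong (shiftXⁿ-shiftX m A)

  shiftXⁿ-shiftT : ∀ m A → shiftXⁿ m (shiftT A) ≈ₚ shiftT (shiftXⁿ m A)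
  shiftXⁿ-shiftT zero    A = ≈ₚ-refl
  shiftXⁿ-shiftT (suc m) A = ≈ₚ-trans (shiftX-cong (shiftXⁿ-shiftT m A)) (shiftX-shiftT (shiftXⁿ m A))

  shiftXⁿ-coeff : ∀ m A i n → shiftXⁿ m A i (m ℕ.+ n) ≡ A i n
  shiftXⁿ-coeff zero    A i n = refl
  shiftXⁿ-coeff (suc m) A i n = shiftXⁿ-coeff m A i n

  shiftXⁿ-coeff-< : ∀ m A i n → n < m → shiftXⁿ m A i n ≡ 0ℚ
  shiftXⁿ-coeff-< (suc m) A i zero    _         = refl
  shiftXⁿ-coeff-< (suc m) A i (suc n) (s≤s n<m) = shiftXⁿ-coeff-< m A i n n<m

  FreeOfT : PS → Set
  FreeOfT A = ∀ i n → A (suc i) n ≡ 0ℚ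

  inX-freeOfT : ∀ P → FreeOfT (inX P)
  inX-freeOfT P i n = refl

  shiftXⁿ-freeOfT : ∀ m A → FreeOfT A → FreeOfT (shiftXⁿ m A)
  shiftXⁿ-freeOfT zero    A free = free
  shiftXⁿ-freeOfT (suc m) A free i zero    = refl
  shiftXⁿ-freeOfT (suc m) A free i (suc n) = shiftXⁿ-freeOfT m A free i n

  shiftTⁿ-coeff : ∀ m A n → shiftTⁿ m A m n ≡ A 0 n
  shiftTⁿ-coeff zero    A n = refl
  shiftTⁿ-coeff (suc m) A n = shiftTⁿ-coeff m A n

  shiftTⁿ-coeff-≢ : ∀ m A → FreeOfT A → ∀ i n → i ≢ m → shiftTⁿ m A i n ≡ 0ℚ
  shiftTⁿ-coeff-≢ zero    A free zero    n i≢0 = contradiction refl i≢0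
  shiftTⁿ-coeff-≢ zero    A free (suc i) n _   = free i n
  shiftTⁿ-coeff-≢ (suc m) A free zero    n _   = refl
  shiftTⁿ-coeff-≢ (suc m) A free (suc i) n i≢m = shiftTⁿ-coeff-≢ m A free i n (i≢m ∘ cong suc)

module GeneratingFunctions (k′ : ℕ) where

  open Raney
  open Series
  open import Data.Nat using (ℕ; zero; suc; _+_; _*_; _∸_; _≤_; _<_)
  import Data.Nat.Properties as ℕ
  open import Data.Nat.Combinatorics using (_C_)
  import Data.Integer as ℤ
  open import Data.Rational as ℚ using (ℚ; 0ℚ; _/_)
  open import Function using (_∘_)
  open import Relation.Binary.PropositionalEquality
  import Relation.Binary.Reasoning.Setoid as SetoidReasoning
  open import Data.Nat.Solver using (module +-*-Solver)
  open +-*-Solver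

  k q : ℕ
  k = suc k′
  q = 2 + k

  raneySeries : ℕ → PS
  raneySeries r = inX (λ n → fromℕ (raney q n r))

  raneySeries-freeOfT : ∀ r → FreeOfT (raneySeries r)
  raneySeries-freeOfT r = inX-freeOfT (λ n → fromℕ (raney q n r))

  raneySeries-⋆ : ∀ r s → raneySeries r ⋆ raneySeries s ≈ₚ raneySeries (r + s)
  raneySeries-⋆ r s = ≈ₚ-trans (inX-⋆-inX _ _) (inX-cong λ n → begin
    sumTo n (λ b → fromℕ (raney q b r) ℚ.* fromℕ (raney q (n ∸ b) s))
      ≡⟨ sumTo-cong n (λ b → fromℕ-* (raney q b r) (raney q (n ∸ b) s)) ⟩
    sumTo n (λ b → fromℕ (raney q b r * raney q (n ∸ b) s))
      ≡⟨ fromℕ-sumToℕ n _ ⟩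
    fromℕ (sumToℕ n (λ b → raney q b r * raney q (n ∸ b) s))
      ≡⟨ cong fromℕ (raney-+ q n r s) ⟨
    fromℕ (raney q n (r + s))
      ∎)
    where open ≡-Reasoning

  Gcoeff≡raney : ∀ n → Gcoeff (suc k) n ≡ fromℕ (raney q n 1)
  Gcoeff≡raney n = trans (cong (λ c → ℤ.+ c / suc N) binom≡) ([d*a]/d≡fromℕ N (raney q n 1))
    where
    N = (suc k + 1) * n
    binom≡ : suc N C n ≡ suc N * raney q n 1
    binom≡ = subst (λ M → M C n ≡ M * raney q n 1)
                   (solve 2 (λ n k′ → n :* (con 3 :+ k′) :+ con 1 := con 1 :+ (con 2 :+ k′ :+ con 1) :* n)
                            refl n k′)
                   (sym (trans (raney-closedForm (suc k) n 1) (ℕ.*-identityˡ _)))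

  powₚ-G : ∀ r → powₚ (G (suc k)) r ≈ₚ raneySeries r
  powₚ-G zero    = ≈ₚ-trans oneₚ≈inX-δ₀ (inX-cong λ { zero → refl ; (suc n) → refl })
  powₚ-G (suc r) =
    ≈ₚ-trans (⋆-cong (powₚ-G r) G≈)
             (≈ₚ-trans (raneySeries-⋆ r 1) (λ i n → cong (λ s → raneySeries s i n) (ℕ.+-comm r 1)))
    where
    G≈ : G (suc k) ≈ₚ raneySeries 1
    G≈ zero    n = Gcoeff≡raney n
    G≈ (suc i) n = refl

  ratio : PS
  ratio = tₚ ⋆ xₚ ⋆ powₚ (G (suc k)) (suc k)

  ratio≈ : ratio ≈ₚ shiftT (shiftX (raneySeries (suc k)))
  ratio≈ = ≈ₚ-trans (tₚ⋆xₚ⋆ _) (shiftT-cong (shiftX-cong (powₚ-G (suc k))))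

  powₚ-ratio : ∀ m → powₚ ratio m ≈ₚ shiftTⁿ m (shiftXⁿ m (raneySeries (m * suc k)))
  powₚ-ratio zero    = powₚ-G 0
  powₚ-ratio (suc m) = begin
    powₚ ratio m ⋆ ratio
      ≈⟨ ⋆-cong (powₚ-ratio m) ratio≈ ⟩
    shiftTⁿ m (shiftXⁿ m R) ⋆ shiftT (shiftX R₁)
      ≈⟨ ≈ₚ-trans (shiftTⁿ-⋆ m (shiftXⁿ m R) (shiftT (shiftX R₁)))
                  (shiftTⁿ-cong m (shiftXⁿ-⋆ m R (shiftT (shiftX R₁)))) ⟩
    shiftTⁿ m (shiftXⁿ m (R ⋆ shiftT (shiftX R₁)))
      ≈⟨ shiftTⁿ-cong m (shiftXⁿ-cong m
           (≈ₚ-trans (inX-⋆-shiftT _ _) (shiftT-cong (inX-⋆-shiftX _ _)))) ⟩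
    shiftTⁿ m (shiftXⁿ m (shiftT (shiftX (R ⋆ R₁))))
      ≈⟨ shiftTⁿ-cong m (shiftXⁿ-cong m (shiftT-cong (shiftX-cong
           (≈ₚ-trans (raneySeries-⋆ (m * suc k) (suc k))
                     (λ i n → cong (λ s → raneySeries s i n) (ℕ.+-comm (m * suc k) (suc k))))))) ⟩
    shiftTⁿ m (shiftXⁿ m (shiftT (shiftX R′)))
      ≈⟨ ≈ₚ-trans (shiftTⁿ-cong m (shiftXⁿ-shiftT m _)) (shiftTⁿ-shiftT m _) ⟩
    shiftT (shiftTⁿ m (shiftXⁿ m (shiftX R′)))
      ≈⟨ shiftT-cong (shiftTⁿ-cong m (shiftXⁿ-shiftX m R′)) ⟩
    shiftT (shiftTⁿ m (shiftX (shiftXⁿ m R′)))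
      ∎
    where
    open SetoidReasoning ≈ₚ-setoid
    R  = raneySeries (m * suc k)
    R₁ = raneySeries (suc k)
    R′ = raneySeries (suc m * suc k)

  -- Only the term m = i of the geometric series reaches t-degree i.
  geomₚ-ratio-coeff : ∀ i n → geomₚ ratio i n ≡ shiftXⁿ i (raneySeries (i * suc k)) 0 n
  geomₚ-ratio-coeff i n = begin
    sumTo (i + n) (λ m → powₚ ratio m i n)
      ≡⟨ sumTo-cong (i + n) (λ m → powₚ-ratio m i n) ⟩
    sumTo (i + n) (λ m → shiftTⁿ m (shiftXⁿ m (R m)) i n)
      ≡⟨ sumTo-single (i + n) i (ℕ.m≤m+n i n)
           (λ m m≢i → shiftTⁿ-coeff-≢ m (shiftXⁿ m (R m)) (shiftXⁿ-freeOfT m (R m) (raneySeries-freeOfT (m * suc k)))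
                                      i n (m≢i ∘ sym)) ⟩
    shiftTⁿ i (shiftXⁿ i (R i)) i n
      ≡⟨ shiftTⁿ-coeff i _ n ⟩
    shiftXⁿ i (R i) 0 n
      ∎
    where
    open ≡-Reasoning
    R : ℕ → PS
    R m = raneySeries (m * suc k)

  rhs : PS
  rhs = (tₚ ⋆ xₚ ⋆ powₚ (G (suc k)) k) ⋆ geomₚ ratio

  rhs≈ : rhs ≈ₚ shiftT (shiftX (raneySeries k ⋆ geomₚ ratio))
  rhs≈ = ≈ₚ-trans (⋆-cong (≈ₚ-trans (tₚ⋆xₚ⋆ _) (shiftT-cong (shiftX-cong (powₚ-G k))))
                          (≈ₚ-refl {geomₚ ratio}))
                  (≈ₚ-trans (shiftT-⋆ (shiftX (raneySeries k)) (geomₚ ratio))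
                            (shiftT-cong (shiftX-⋆ (raneySeries k) (geomₚ ratio))))

  raneySeries-⋆-geomₚ-ratio : ∀ j n →
    (raneySeries k ⋆ geomₚ ratio) j n ≡ shiftXⁿ j (raneySeries (k + j * suc k)) 0 n
  raneySeries-⋆-geomₚ-ratio j n = begin
    (inX Pₖ ⋆ geomₚ ratio) j n
      ≡⟨ inX-⋆-coeff Pₖ (geomₚ ratio) j n ⟩
    sumTo n (λ b → Pₖ b ℚ.* geomₚ ratio j (n ∸ b))
      ≡⟨ sumTo-cong n (λ b → cong (Pₖ b ℚ.*_) (geomₚ-ratio-coeff j (n ∸ b))) ⟩
    sumTo n (λ b → Pₖ b ℚ.* shiftXⁿ j (raneySeries (j * suc k)) 0 (n ∸ b))
      ≡⟨ inX-⋆-coeff Pₖ (shiftXⁿ j (raneySeries (j * suc k))) 0 n ⟨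
    (inX Pₖ ⋆ shiftXⁿ j (raneySeries (j * suc k))) 0 n
      ≡⟨ ≈ₚ-trans (inX-⋆-shiftXⁿ j Pₖ (raneySeries (j * suc k)))
                  (shiftXⁿ-cong j (raneySeries-⋆ k (j * suc k))) 0 n ⟩
    shiftXⁿ j (raneySeries (k + j * suc k)) 0 n
      ∎
    where
    open ≡-Reasoning
    Pₖ : ℕ → ℚ
    Pₖ b = fromℕ (raney q b k)

  rhs-coeff : ∀ j n → j ≤ n → rhs (suc j) (suc n) ≡ fromℕ (raney q (n ∸ j) (k + j * suc k))
  rhs-coeff j n j≤n = begin
    rhs (suc j) (suc n)
      ≡⟨ rhs≈ (suc j) (suc n) ⟩
    (raneySeries k ⋆ geomₚ ratio) j n
      ≡⟨ raneySeries-⋆-geomₚ-ratio j n ⟩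
    shiftXⁿ j (raneySeries (k + j * suc k)) 0 n
      ≡⟨ cong (shiftXⁿ j _ 0) (ℕ.m+[n∸m]≡n j≤n) ⟨
    shiftXⁿ j (raneySeries (k + j * suc k)) 0 (j + (n ∸ j))
      ≡⟨ shiftXⁿ-coeff j _ 0 (n ∸ j) ⟩
    fromℕ (raney q (n ∸ j) (k + j * suc k))
      ∎
    where open ≡-Reasoning

  rhs-coeff-< : ∀ j n → n < j → rhs (suc j) (suc n) ≡ 0ℚ
  rhs-coeff-< j n n<j =
    trans (rhs≈ (suc j) (suc n)) (trans (raneySeries-⋆-geomₚ-ratio j n) (shiftXⁿ-coeff-< j _ 0 n n<j))

open BoxPathCount using (fBox-raney; fBox-zero)
open Series using (fromℕ)

lemma6p1 : (k : ℕ) → 1 ≤ k →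
    F̀ k ≈ₚ (tₚ ⋆ xₚ ⋆ powₚ (G (suc k)) k) ⋆ geomₚ (tₚ ⋆ xₚ ⋆ powₚ (G (suc k)) (suc k))
lemma6p1 (suc k′) _ = F̀≈rhs
  where
  open GeneratingFunctions k′
  F̀≈rhs : F̀ (suc k′) ≈ₚ rhs
  F̀≈rhs zero    n       = sym (rhs≈ zero n)
  F̀≈rhs (suc j) zero    = sym (rhs≈ (suc j) zero)
  F̀≈rhs (suc j) (suc n) with j ≤? n
  ... | yes j≤n = trans (cong fromℕ (fBox-raney k′ n j (n ∸ j) (sym (m∸n+n≡m j≤n))))
                        (sym (rhs-coeff j n j≤n))
  ... | no  j≰n = trans (cong fromℕ (fBox-zero k′ n j (≰⇒> j≰n)))
                        (sym (rhs-coeff-< j n (≰⇒> j≰n)))
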